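{- Let $h$ be an even positive integer and $c$ an even positive integer. Let $T$, $\lambda$, $A$, $G$, the leaf $u$ of $T_{\mathsf L}$, the path set $\mathcal P$, rank and pattern be as described in the context. Fix $r\ge1$. Then there is a constant $C$ depending only on $c$ (for instance $C=3/\big((1-2/\sqrt6^{\,c/2})(1-\sqrt{2/3})\big)$) such that for every $0\le \ell\le r$ and every sequence $t_{[2\ell]}=(t_1,\dots,t_{2\ell})$ that is a prefix of some valid pattern of rank $r$, $$\big|\mathcal P_{t_{[2\ell]}}\big|\le 2C^{\,r-\ell}\left(\tfrac32\right)^{\ell}\prod_{i=1}^{\ell}\Big[\lambda(t_{2i-1})\,2^{t_{2i}}\Big]\cdot\sqrt6^{\,W(t_{[2\ell]})}.$$
   Context: $T$ is the rooted tree of depth $h$ in which every vertex at depth $0,\dots,h/2-1$ has $3$ children and every vertex at depth $h/2,\dots,h-1$ has $2$ children ($n=6^{h/2}$ leaves); $\lambda(s)=2^s$ for $0\le s\le h/2$ and $\lambda(s)=2^{h/2}3^{s-h/2}$ for $h/2<s\le h$. $A$ is a graph on $2n$ vertices with all degrees $3$. $G$ is obtained from disjoint copies $T_{\mathsf L},T_{\mathsf R}$ of $T$ and $A$ by adding a vertex $v^*$ adjacent to both roots, joining each of the $2n$ leaves to its image under a fixed bijection onto $V(A)$ by a path of length $c$, and replacing each edge of $A$ by a path of length $c$. $u$ is a fixed leaf of $T_{\mathsf L}$ and $\mathcal P$ is the set of simple paths in $G\setminus\{v^*\}$ from $u$ to a leaf of $T_{\mathsf R}$. Each such path alternates: tree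 segment (in $T_{\mathsf L}$ or $T_{\mathsf R}$, leaf to leaf, possibly of length $0$ for the first and last), connecting path of length $c$, expander segment (between vertices of $A$ along subdivided edges), connecting path of length $c$, tree segment, etc. Its rank $r$ is the number of expander segments, and its pattern is $(t_1,\dots,t_{2r+1})$ where $2t_{2i-1}$ is the length of the $i$-th tree segment and $c\,t_{2i}$ the length of the $i$-th expander segment; its length is $\mathrm{len}(t)=2\sum_{i=1}^{r+1}t_{2i-1}+c\sum_{i=1}^{r}(t_{2i}+2)$. A sequence of non-negative integers $(t_1,\dots,t_{2r+1})$ is a valid pattern of rank $r$ if $\mathrm{len}(t)\le 2h+2$. For a prefix $t_{[2\ell]}$ ($0\le\ell\le r$) or $t_{[2\ell-1]}$ ($1\le\ell\le r$) of a valid pattern of rank $r$ define $$W(t_{[2\ell]})=\Big\lfloor \tfrac{2h+2-2\sum_{i=1}^{\ell}t_{2i-1}-c\sum_{i=1}^{\ell}(t_{2i}+2)-2c(r-\ell)}{2}\Big\rfloor,$$ $$W(t_{[2\ell-1]})=\Big\lfloor \tfrac{2h+2-2\sum_{i=1}^{\ell}t_{2i-1}-c\sum_{i=1}^{\ell-1}(t_{2i}+2)-2c(r-\ell)}{c}\Big\rfloor-2.$$ $\mathcal P_{t_{[2\ell]}}$ is the set of paths $P\in\mathcal P$ of rank $r$ whose pattern is a valid pattern of rank $r$ having $t_{[2\ell]}$ as a prefix. -}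

module Defs where

open import Data.Nat using (ℕ; zero; suc; _+_; _*_; _∸_; _^_; _≤_; _<_; _<ᵇ_; _≤ᵇ_)
open import Data.Nat.DivMod using (_/_)
open import Data.Bool using (if_then_else_)
open import Data.Fin using (Fin; toℕ)
open import Data.List using (List; []; _∷_; _++_; length; replicate; map)
open import Data.List.Membership.Propositional using (_∈_)
open import Data.List.Relation.Unary.All using (All)
open import Data.List.Relation.Unary.Unique.Propositional using (Unique)
open import Data.Product using (_×_; ∃; ∃-syntax; Σ)
open import Data.Sum using (_⊎_)
open import Data.Unit using (⊤)
open import Relation.Nullary using (¬_)
open import Relation.Binary.PropositionalEquality using (_≡_)

data Side : Set where
  L R : Side

branching : ℕ → ℕ → ℕ
branching h i = if i <ᵇ h / 2 then 3 else 2

-- A vertex of T is its address: the list of child indices from the root.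
ValidAddrFrom : ℕ → ℕ → List ℕ → Set
ValidAddrFrom h i []       = ⊤
ValidAddrFrom h i (x ∷ xs) = i < h × x < branching h i × ValidAddrFrom h (suc i) xs

ValidAddr : ℕ → List ℕ → Set
ValidAddr h = ValidAddrFrom h 0

IsLeaf : ℕ → List ℕ → Set
IsLeaf h a = length a ≡ h × ValidAddr h a

lam : ℕ → ℕ → ℕ
lam h s = if s ≤ᵇ h / 2 then 2 ^ s else 2 ^ (h / 2) * 3 ^ (s ∸ h / 2)

IsCubic : {N : ℕ} → (Fin N → Fin N → Set) → Set
IsCubic {N} adjA =
  (∀ x y → adjA x y → adjA y x) ×
  (∀ x → ¬ adjA x x) ×
  (∀ x → ∃[ ys ] (length ys ≡ 3 × Unique ys ×
                  (∀ y → (adjA x y → y ∈ ys) × (y ∈ ys → adjA x y))))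

IsLeafBijection : {N : ℕ} → ℕ → (Side → List ℕ → Fin N) → Set
IsLeafBijection h f =
  (∀ s s' a a' → IsLeaf h a → IsLeaf h a' → f s a ≡ f s' a' → s ≡ s' × a ≡ a') ×
  (∀ x → ∃[ s ] ∃[ a ] (IsLeaf h a × f s a ≡ x))

data V (N : ℕ) : Set where
  star  : V N
  tree  : Side → List ℕ → V N
  conn  : Side → List ℕ → ℕ → V N      -- conn s a j : j-th internal vertex (distance j from leaf a) of its connecting path
  avert : Fin N → V N
  sub   : Fin N → Fin N → ℕ → V N      -- sub a b j (a < b): internal vertex at distance j from a on the subdivided edge ab

-- which raw vertices actually exist in G
ValidV : {N : ℕ} → ℕ → ℕ → (Fin N → Fin N → Set) → V N → Set
ValidV h c adjA star        = ⊤
ValidV h c adjA (tree s a)  = ValidAddr h a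
ValidV h c adjA (conn s a j) = IsLeaf h a × 1 ≤ j × j ≤ c ∸ 1
ValidV h c adjA (avert x)   = ⊤
ValidV h c adjA (sub a b j) = toℕ a < toℕ b × adjA a b × 1 ≤ j × j ≤ c ∸ 1

-- edges of G, in one orientation (endpoints are required to be valid separately)
data DirEdge {N : ℕ} (c : ℕ) (f : Side → List ℕ → Fin N) : V N → V N → Set where
  root     : ∀ s → DirEdge c f star (tree s [])
  child    : ∀ s a x → DirEdge c f (tree s a) (tree s (a ++ x ∷ []))
  leafConn : ∀ s a → DirEdge c f (tree s a) (conn s a 1)
  connConn : ∀ s a j → DirEdge c f (conn s a j) (conn s a (suc j))
  connA    : ∀ s a → DirEdge c f (conn s a (c ∸ 1)) (avert (f s a))
  aSub     : ∀ a b → DirEdge c f (avert a) (sub a b 1)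
  subSub   : ∀ a b j → DirEdge c f (sub a b j) (sub a b (suc j))
  subA     : ∀ a b → DirEdge c f (sub a b (c ∸ 1)) (avert b)

Adj : {N : ℕ} → ℕ → (Side → List ℕ → Fin N) → V N → V N → Set
Adj c f x y = DirEdge c f x y ⊎ DirEdge c f y x

IsWalk : {N : ℕ} → ℕ → (Side → List ℕ → Fin N) → List (V N) → Set
IsWalk c f []           = ⊤
IsWalk c f (x ∷ [])     = ⊤
IsWalk c f (x ∷ y ∷ zs) = Adj c f x y × IsWalk c f (y ∷ zs)

InPathSet : {N : ℕ} → ℕ → ℕ → (Fin N → Fin N → Set) → (Side → List ℕ → Fin N) →
            List ℕ → List (V N) → Set
InPathSet h c adjA f u P =
  IsWalk c f P × All (ValidV h c adjA) P × Unique P × ¬ (star ∈ P) ×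
  (∃[ ys ] P ≡ tree L u ∷ ys) ×
  (∃[ xs ] ∃[ a ] (IsLeaf h a × P ≡ xs ++ tree R a ∷ []))

data Region : Set where
  Tr Cn Ex St : Region

region : {N : ℕ} → V N → Region
region star         = St
region (tree _ _)   = Tr
region (conn _ _ _) = Cn
region (avert _)    = Ex
region (sub _ _ _)  = Ex

-- region sequence of a path with pattern (t1,...,t_{2r+1}):
-- tree segment of length 2 t1 (2 t1 + 1 vertices), connecting path of length c
-- (c-1 internal vertices), expander segment of length c t2 (c t2 + 1 vertices), ...
expected : ℕ → List ℕ → List Region
expected c []           = []
expected c (t ∷ [])     = replicate (2 * t + 1) Tr
expected c (t ∷ e ∷ ts) =
  replicate (2 * t + 1) Tr ++ replicate (c ∸ 1) Cn ++ replicate (c * e + 1) Ex ++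
  replicate (c ∸ 1) Cn ++ expected c ts

sumOdd : List ℕ → ℕ
sumOdd []           = 0
sumOdd (x ∷ [])     = x
sumOdd (x ∷ y ∷ xs) = x + sumOdd xs

sumEven2 : List ℕ → ℕ
sumEven2 []           = 0
sumEven2 (x ∷ [])     = 0
sumEven2 (x ∷ y ∷ xs) = (y + 2) + sumEven2 xs

patLen : ℕ → List ℕ → ℕ
patLen c t = 2 * sumOdd t + c * sumEven2 t

ValidPattern : ℕ → ℕ → ℕ → List ℕ → Set
ValidPattern h c r t = length t ≡ 2 * r + 1 × patLen c t ≤ 2 * h + 2

IsPrefixOfValid : ℕ → ℕ → ℕ → List ℕ → Set
IsPrefixOfValid h c r s = ∃[ t ] (ValidPattern h c r t × ∃[ rest ] t ≡ s ++ rest)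

InPs : {N : ℕ} → ℕ → ℕ → (Fin N → Fin N → Set) → (Side → List ℕ → Fin N) →
       List ℕ → ℕ → List ℕ → List (V N) → Set
InPs h c adjA f u r s P =
  InPathSet h c adjA f u P ×
  ∃[ t ] (ValidPattern h c r t × (∃[ rest ] t ≡ s ++ rest) × map region P ≡ expected c t)

W : ℕ → ℕ → ℕ → ℕ → List ℕ → ℕ
W h c r ℓ s = ((2 * h + 2) ∸ 2 * sumOdd s ∸ c * sumEven2 s ∸ 2 * c * (r ∸ ℓ)) / 2

prodTerm : ℕ → List ℕ → ℕ
prodTerm h []           = 1
prodTerm h (x ∷ [])     = 1
prodTerm h (x ∷ y ∷ xs) = lam h x * 2 ^ y * prodTerm h xs

module Submission where

-- Theorem 7: a bound on the number of paths of 𝒫 with a given prefix  t[2ℓ]  of their pattern,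
-- with the constant  C = 19 · 513 = 9747.  All quantities are squared so that √6 and 3/2 become the
-- integers 6 and 9/4, and √6^x is replaced by  H x = 6^⌊x/2⌋.
--
-- The proof is a weighted enumeration.  For every pattern t we build an explicit list  paths L u t
-- of vertex sequences and prove it complete: each path of 𝒫 with pattern t occurs in it, because
-- connecting paths and subdivided edges are forced, a tree segment of length 2t between leaves climbs
-- t levels and descends t levels, and an expander segment is a non-backtracking walk in the cubic
-- graph A.  The list has at most  wt t = ∏ λ(t_odd) · ∏ ce(t_even)  elements, where ce(e) = 3·2^(e-1)
-- counts non-backtracking walks.  Summing wt over all suffixes of valid patterns extending the
-- prefix is a convolution estimate against H (ratio 2 below the threshold h/2 and 3 above it), and
-- the pigeonhole principle bounds |𝒫_{t[2ℓ]}| by the prefix weight times that sum.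

open import Data.Bool using (true; false; T; if_then_else_)
open import Data.Empty using (⊥)
open import Data.Fin using (Fin; toℕ) renaming (_≟_ to _≟ᶠ_)
open import Data.List using (List; []; _∷_; _++_; map; concatMap; length; downFrom; [_]; replicate; filter)
open import Data.List.Membership.Propositional using (_∈_; _∉_)
open import Data.List.Membership.Propositional.Properties
  using (∈-map⁺; ∈-concat⁺′; ∈-downFrom⁺; ∈-++⁺ˡ; ∈-++⁺ʳ; ∈-++⁻; ∈-∃++; ∈-filter⁺; ∈-filter⁻)
open import Data.List.Properties
  using (map-++; ++-assoc; ++-identityʳ; ∷-injective; ∷ʳ-injective; length-map; length-++; length-downFrom; filter-notAll)
open import Data.List.Relation.Unary.All as All using (All; _∷_)
open import Data.List.Relation.Unary.AllPairs using (_∷_)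
open import Data.List.Relation.Unary.Any as Any using (here; there)
open import Data.List.Relation.Unary.Unique.Propositional using (Unique)
open import Data.Maybe using (Maybe; just; nothing)
open import Data.Nat
open import Data.Nat.DivMod using (_/_; m*n/n≡m)
open import Data.Nat.Divisibility using (_∣_; divides)
open import Data.Nat.ListAction using (sum)
open import Data.Nat.ListAction.Properties using (sum-++)
open import Data.Nat.Properties
open import Data.Nat.Tactic.RingSolver using (solve-∀)
open import Data.Product using (∃-syntax; _×_; _,_; proj₁; proj₂)
open import Data.Sum using (_⊎_; inj₁; inj₂)
open import Data.Unit using (⊤; tt)
open import Relation.Binary.PropositionalEquality hiding ([_])
open import Relation.Nullary using (Dec; yes; no; ¬_; ¬?; contradiction)

open import Defs

sumBelow : ℕ → (ℕ → ℕ) → ℕ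
sumBelow zero    f = 0
sumBelow (suc n) f = f n + sumBelow n f

sumBelow-mono : ∀ n {f g : ℕ → ℕ} → (∀ t → t < n → f t ≤ g t) → sumBelow n f ≤ sumBelow n g
sumBelow-mono zero    f≤g = z≤n
sumBelow-mono (suc n) f≤g = +-mono-≤ (f≤g n ≤-refl) (sumBelow-mono n (λ t t<n → f≤g t (m<n⇒m<1+n t<n)))

sumBelow-cong : ∀ n {f g : ℕ → ℕ} → (∀ t → t < n → f t ≡ g t) → sumBelow n f ≡ sumBelow n g
sumBelow-cong zero    f≡g = refl
sumBelow-cong (suc n) f≡g = cong₂ _+_ (f≡g n ≤-refl) (sumBelow-cong n (λ t t<n → f≡g t (m<n⇒m<1+n t<n)))

sumBelow-scale : ∀ n k (f : ℕ → ℕ) → sumBelow n (λ t → k * f t) ≡ k * sumBelow n f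
sumBelow-scale zero    k f = sym (*-zeroʳ k)
sumBelow-scale (suc n) k f =
  trans (cong (k * f n +_) (sumBelow-scale n k f)) (sym (*-distribˡ-+ k (f n) (sumBelow n f)))

sumBelow-add : ∀ n (f g : ℕ → ℕ) → sumBelow n (λ t → f t + g t) ≡ sumBelow n f + sumBelow n g
sumBelow-add zero    f g = refl
sumBelow-add (suc n) f g rewrite sumBelow-add n f g = shuffle (f n) (g n) (sumBelow n f) (sumBelow n g)
  where shuffle : ∀ a b c d → a + b + (c + d) ≡ a + c + (b + d)
        shuffle = solve-∀

sumBelow-extend : ∀ m n (f : ℕ → ℕ) → m ≤ n → sumBelow m f ≤ sumBelow n f
sumBelow-extend m n f m≤n with m≤n⇒∃[o]m+o≡n m≤n
... | o , refl = go o
  where go : ∀ o → sumBelow m f ≤ sumBelow (m + o) f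
        go zero    = ≤-reflexive (cong (λ k → sumBelow k f) (sym (+-identityʳ m)))
        go (suc o) rewrite +-suc m o = ≤-trans (go o) (m≤n+m _ (f (m + o)))

sumBelow-vanish : ∀ m n (f : ℕ → ℕ) → m ≤ n → (∀ t → m ≤ t → f t ≡ 0) → sumBelow n f ≡ sumBelow m f
sumBelow-vanish m n f m≤n f≡0 with m≤n⇒∃[o]m+o≡n m≤n
... | o , refl = go o
  where go : ∀ o → sumBelow (m + o) f ≡ sumBelow m f
        go zero    = cong (λ k → sumBelow k f) (+-identityʳ m)
        go (suc o) rewrite +-suc m o | f≡0 (m + o) (m≤m+n m o) = go o

onlyIf : {P : Set} → Dec P → ℕ → ℕ
onlyIf (yes _) x = x
onlyIf (no _)  _ = 0

onlyIf-≤ : ∀ {P : Set} (d : Dec P) x → onlyIf d x ≤ x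
onlyIf-≤ (yes _) x = ≤-refl
onlyIf-≤ (no _)  x = z≤n

onlyIf-yes : ∀ {P : Set} (d : Dec P) x → P → onlyIf d x ≡ x
onlyIf-yes (yes _)  x p = refl
onlyIf-yes (no ¬p) x p = contradiction p ¬p

onlyIf-no : ∀ {P : Set} (d : Dec P) x → ¬ P → onlyIf d x ≡ 0
onlyIf-no (yes p) x ¬p = contradiction p ¬p
onlyIf-no (no _)  x ¬p = refl

sumBelow-0 : ∀ n → sumBelow n (λ _ → 0) ≡ 0
sumBelow-0 zero    = refl
sumBelow-0 (suc n) = sumBelow-0 n

sumBelow-truncate : ∀ n Y (g : ℕ → ℕ) → sumBelow n (λ t → onlyIf (t ≤? Y) (g t)) ≤ sumBelow (suc Y) g
sumBelow-truncate n Y g with n ≤? suc Y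
... | yes n≤ = ≤-trans (sumBelow-mono n (λ t _ → onlyIf-≤ (t ≤? Y) (g t))) (sumBelow-extend n (suc Y) g n≤)
... | no  n≰ = begin
  sumBelow n (λ t → onlyIf (t ≤? Y) (g t))
    ≡⟨ sumBelow-vanish (suc Y) n _ (<⇒≤ (≰⇒> n≰)) (λ t Y<t → onlyIf-no (t ≤? Y) (g t) (<⇒≱ Y<t)) ⟩
  sumBelow (suc Y) (λ t → onlyIf (t ≤? Y) (g t))
    ≤⟨ sumBelow-mono (suc Y) (λ t _ → onlyIf-≤ (t ≤? Y) (g t)) ⟩
  sumBelow (suc Y) g ∎
  where open ≤-Reasoning

listIf : {P : Set} {A : Set} → Dec P → List A → List A
listIf (yes _) xs = xs
listIf (no _)  _  = []

listIf-yes : ∀ {P A : Set} (d : Dec P) (xs : List A) → P → listIf d xs ≡ xs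
listIf-yes (yes _)  xs p = refl
listIf-yes (no ¬p) xs p = contradiction p ¬p

∈-concatMap : ∀ {A B : Set} {g : A → List B} {x : A} {xs : List A} {y : B} →
              y ∈ g x → x ∈ xs → y ∈ concatMap g xs
∈-concatMap {g = g} y∈gx x∈xs = ∈-concat⁺′ y∈gx (∈-map⁺ g x∈xs)

length-concatMap-≤ : ∀ {A B : Set} (xs : List A) (g : A → List B) M → (∀ y → y ∈ xs → length (g y) ≤ M) →
                     length (concatMap g xs) ≤ length xs * M
length-concatMap-≤ []       g M bound = z≤n
length-concatMap-≤ (x ∷ xs) g M bound =
  ≤-trans (≤-reflexive (length-++ (g x))) (+-mono-≤ (bound x (here refl)) (length-concatMap-≤ xs g M (λ y y∈ → bound y (there y∈))))

length-concatMap-sum : ∀ {A B : Set} (xs : List A) (g : A → List B) (F : A → ℕ) → (∀ x → length (g x) ≤ F x) →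
                       length (concatMap g xs) ≤ sum (map F xs)
length-concatMap-sum []       g F bound = z≤n
length-concatMap-sum (x ∷ xs) g F bound = ≤-trans (≤-reflexive (length-++ (g x))) (+-mono-≤ (bound x) (length-concatMap-sum xs g F bound))

sum-map-scale : ∀ {A : Set} (xs : List A) (F : A → ℕ) k → sum (map (λ x → k * F x) xs) ≡ k * sum (map F xs)
sum-map-scale []       F k = sym (*-zeroʳ k)
sum-map-scale (x ∷ xs) F k = trans (cong (k * F x +_) (sum-map-scale xs F k)) (sym (*-distribˡ-+ k (F x) _))

unique-length-≤ : ∀ {A : Set} (xs ys : List A) → Unique xs → (∀ x → x ∈ xs → x ∈ ys) → length xs ≤ length ys
unique-length-≤ []       ys _              _   = z≤n
unique-length-≤ (x ∷ xs) ys (x∉xs ∷ uniq) xs⊆ with ∈-∃++ (xs⊆ x (here refl))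
... | ys₁ , ys₂ , refl = begin
  suc (length xs)            ≤⟨ s≤s (unique-length-≤ xs (ys₁ ++ ys₂) uniq xs⊆ys₁ys₂) ⟩
  suc (length (ys₁ ++ ys₂))  ≡⟨ cong suc (length-++ ys₁) ⟩
  suc (length ys₁ + length ys₂) ≡⟨ +-suc (length ys₁) (length ys₂) ⟨
  length ys₁ + length (x ∷ ys₂) ≡⟨ length-++ ys₁ ⟨
  length (ys₁ ++ x ∷ ys₂)    ∎
  where
  open ≤-Reasoning
  xs⊆ys₁ys₂ : ∀ y → y ∈ xs → y ∈ ys₁ ++ ys₂
  xs⊆ys₁ys₂ y y∈xs with ∈-++⁻ ys₁ (xs⊆ y (there y∈xs))
  ... | inj₁ y∈ys₁         = ∈-++⁺ˡ y∈ys₁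
  ... | inj₂ (here y≡x)    = contradiction (sym y≡x) (All.lookup x∉xs y∈xs)
  ... | inj₂ (there y∈ys₂) = ∈-++⁺ʳ ys₁ y∈ys₂

1≢suc+1 : ∀ n → 1 ≢ suc n + 1
1≢suc+1 n eq = 0≢1+n (trans (suc-injective eq) (+-comm n 1))

odd-length-tail : ∀ {A : Set} {r : List A} m → suc (suc (length r)) ≡ 2 * suc m + 1 → length r ≡ 2 * m + 1
odd-length-tail m len = suc-injective (suc-injective (trans len (shift m)))
  where shift : ∀ m → 2 * suc m + 1 ≡ suc (suc (2 * m + 1))
        shift = solve-∀

even-length-tail : ∀ {A : Set} {r : List A} ℓ → suc (suc (length r)) ≡ 2 * suc ℓ → length r ≡ 2 * ℓ
even-length-tail ℓ len = suc-injective (suc-injective (trans len (shift ℓ)))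
  where shift : ∀ ℓ → 2 * suc ℓ ≡ suc (suc (2 * ℓ))
        shift = solve-∀

1≢2*suc : ∀ ℓ → 1 ≢ 2 * suc ℓ
1≢2*suc ℓ eq = 0≢1+n (trans (suc-injective eq) (+-suc ℓ (ℓ + 0)))

sumOdd-++ : ∀ ℓ (s rest : List ℕ) → length s ≡ 2 * ℓ → sumOdd (s ++ rest) ≡ sumOdd s + sumOdd rest
sumOdd-++ zero    []          rest _   = refl
sumOdd-++ (suc ℓ) (x ∷ [])    rest len = contradiction len (1≢2*suc ℓ)
sumOdd-++ (suc ℓ) (x ∷ y ∷ s) rest len =
  trans (cong (x +_) (sumOdd-++ ℓ s rest (even-length-tail {r = s} ℓ len))) (sym (+-assoc x (sumOdd s) (sumOdd rest)))

sumEven2-++ : ∀ ℓ (s rest : List ℕ) → length s ≡ 2 * ℓ → sumEven2 (s ++ rest) ≡ sumEven2 s + sumEven2 rest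
sumEven2-++ zero    []          rest _   = refl
sumEven2-++ (suc ℓ) (x ∷ [])    rest len = contradiction len (1≢2*suc ℓ)
sumEven2-++ (suc ℓ) (x ∷ y ∷ s) rest len =
  trans (cong ((y + 2) +_) (sumEven2-++ ℓ s rest (even-length-tail {r = s} ℓ len))) (sym (+-assoc (y + 2) (sumEven2 s) (sumEven2 rest)))

if-true : ∀ {A : Set} b {x y : A} → T b → (if b then x else y) ≡ x
if-true true _ = refl

if-false : ∀ {A : Set} b {x y : A} → ¬ T b → (if b then x else y) ≡ y
if-false true  ¬t = contradiction tt ¬t
if-false false _  = refl

pow-mul : ∀ m n o → (m * n) ^ o ≡ m ^ o * n ^ o
pow-mul m n zero    = refl
pow-mul m n (suc o) rewrite pow-mul m n o = shuffle m n (m ^ o) (n ^ o)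
  where shuffle : ∀ m n p q → m * n * (p * q) ≡ m * p * (n * q)
        shuffle = solve-∀

-- H x = 6 ^ ⌊x/2⌋, the integer version of √6^x used throughout the counting.
H : ℕ → ℕ
H zero          = 1
H (suc zero)    = 1
H (suc (suc n)) = 6 * H n

H-pos : ∀ n → 1 ≤ H n
H-pos zero          = ≤-refl
H-pos (suc zero)    = ≤-refl
H-pos (suc (suc n)) = ≤-trans (H-pos n) (m≤n*m (H n) 6)

H-suc : ∀ n → H n ≤ H (suc n)
H-suc zero          = ≤-refl
H-suc (suc zero)    = s≤s z≤n
H-suc (suc (suc n)) = *-monoʳ-≤ 6 (H-suc n)

H-mono : ∀ {m n} → m ≤ n → H m ≤ H n
H-mono {m} m≤n with m≤n⇒∃[o]m+o≡n m≤n
... | o , refl = go o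
  where go : ∀ o → H m ≤ H (m + o)
        go zero    = ≤-reflexive (cong H (sym (+-identityʳ m)))
        go (suc o) rewrite +-suc m o = ≤-trans (go o) (H-suc (m + o))

H-sq : ∀ x → H x * H x ≤ 6 ^ x
H-sq zero          = ≤-refl
H-sq (suc zero)    = s≤s z≤n
H-sq (suc (suc x)) = begin
  6 * H x * (6 * H x) ≡⟨ shuffle (H x) ⟩
  36 * (H x * H x)    ≤⟨ *-monoʳ-≤ 36 (H-sq x) ⟩
  36 * 6 ^ x          ≡⟨ *-assoc 6 6 (6 ^ x) ⟩
  6 ^ suc (suc x)     ∎
  where open ≤-Reasoning
        shuffle : ∀ z → 6 * z * (6 * z) ≡ 36 * (z * z)
        shuffle = solve-∀

H-2* : ∀ b y → H (2 * b + y) ≡ 6 ^ b * H y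
H-2* zero    y = sym (+-identityʳ (H y))
H-2* (suc b) y = begin
  H (2 * suc b + y)     ≡⟨ cong H (shift b y) ⟩
  6 * H (2 * b + y)     ≡⟨ cong (6 *_) (H-2* b y) ⟩
  6 * (6 ^ b * H y)     ≡⟨ *-assoc 6 (6 ^ b) (H y) ⟨
  6 ^ suc b * H y       ∎
  where open ≡-Reasoning
        shift : ∀ b y → 2 * suc b + y ≡ suc (suc (2 * b + y))
        shift = solve-∀

pow2≤2H : ∀ n → 2 ^ n ≤ 2 * H n
pow2≤2H zero          = s≤s z≤n
pow2≤2H (suc zero)    = ≤-refl
pow2≤2H (suc (suc n)) = begin
  2 * (2 * 2 ^ n) ≡⟨ *-assoc 2 2 (2 ^ n) ⟨
  4 * 2 ^ n       ≤⟨ *-monoʳ-≤ 4 (pow2≤2H n) ⟩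
  4 * (2 * H n)   ≤⟨ *-monoˡ-≤ (2 * H n) (m≤m+n 4 2) ⟩
  6 * (2 * H n)   ≡⟨ swap (H n) ⟩
  2 * (6 * H n)   ∎
  where open ≤-Reasoning
        swap : ∀ z → 6 * (2 * z) ≡ 2 * (6 * z)
        swap = solve-∀

conv : (ℕ → ℕ) → ℕ → ℕ
conv g X = sumBelow (suc X) (λ t → g t * H (X ∸ t))

conv-step : ∀ g X → conv g (suc (suc X)) ≡ g (suc (suc X)) + (g (suc X) + 6 * conv g X)
conv-step g X = cong₂ _+_ last (cong₂ _+_ secondLast shifted)
  where
  last : g (suc (suc X)) * H (suc (suc X) ∸ suc (suc X)) ≡ g (suc (suc X))
  last rewrite n∸n≡0 X = *-identityʳ (g (suc (suc X)))
  secondLast : g (suc X) * H (suc (suc X) ∸ suc X) ≡ g (suc X)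
  secondLast rewrite +-∸-assoc 1 (≤-refl {X}) | n∸n≡0 X = *-identityʳ (g (suc X))
  term : ∀ t → t < suc X → g t * H (suc (suc X) ∸ t) ≡ 6 * (g t * H (X ∸ t))
  term t t≤X rewrite +-∸-assoc 2 (≤-pred t≤X) = swap (g t) (H (X ∸ t))
    where swap : ∀ p q → p * (6 * q) ≡ 6 * (p * q)
          swap = solve-∀
  shifted : sumBelow (suc X) (λ t → g t * H (suc (suc X) ∸ t)) ≡ 6 * conv g X
  shifted = trans (sumBelow-cong (suc X) term) (sumBelow-scale (suc X) 6 (λ t → g t * H (X ∸ t)))

-- A geometric series of ratio 2 < √6 has convolution of the same order as H.
conv-pow2 : ∀ X → conv (2 ^_) X ≤ 9 * H X
conv-pow2 X = ≤-trans (m≤m+n _ _) (strong X)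
  where
  strong : ∀ X → conv (2 ^_) X + 3 * 2 ^ X ≤ 9 * H X
  strong zero          = s≤s (s≤s (s≤s (s≤s z≤n)))
  strong (suc zero)    = ≤-refl
  strong (suc (suc X)) rewrite conv-step (2 ^_) X = begin
    2 * (2 * p) + (2 * p + 6 * conv (2 ^_) X) + 3 * (2 * (2 * p)) ≡⟨ regroup (conv (2 ^_) X) p ⟩
    6 * (conv (2 ^_) X + 3 * p)                                   ≤⟨ *-monoʳ-≤ 6 (strong X) ⟩
    6 * (9 * H X)                                                 ≡⟨ swap (H X) ⟩
    9 * (6 * H X)                                                 ∎
    where open ≤-Reasoning
          p : ℕ
          p = 2 ^ X
          regroup : ∀ c p → 2 * (2 * p) + (2 * p + 6 * c) + 3 * (2 * (2 * p)) ≡ 6 * (c + 3 * p)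
          regroup = solve-∀
          swap : ∀ z → 6 * (9 * z) ≡ 9 * (6 * z)
          swap = solve-∀

-- ce e is the number of non-backtracking walks with e steps from a vertex of a cubic graph
-- (3 · 2^(e-1), and 1 for e = 0): the weight of an expander segment made of e subdivided edges.
ce : ℕ → ℕ
ce zero    = 1
ce (suc e) = 3 * 2 ^ e

ce≤ : ∀ e → ce e ≤ 3 * 2 ^ e
ce≤ zero    = s≤s z≤n
ce≤ (suc e) = *-monoʳ-≤ 3 (m≤m+n (2 ^ e) (2 ^ e + 0))

-- Weights of tree segments in the tree of depth  h = a + a  (branching 3 above depth a, 2 below).
-- lamA t is λ(t); μ t = λ(t) for t ≤ h and 0 beyond, bounding the number of segments that climb t
-- levels from a leaf and descend t levels again; ν is the part of μ above the threshold a.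
module TreeWeight (a : ℕ) where

  lamA : ℕ → ℕ
  lamA t with t ≤? a
  ... | yes _ = 2 ^ t
  ... | no  _ = 2 ^ a * 3 ^ (t ∸ a)

  μ : ℕ → ℕ
  μ t with t ≤? a + a
  ... | yes _ = lamA t
  ... | no  _ = 0

  ν : ℕ → ℕ
  ν t with t ≤? a
  ... | yes _ = 0
  ... | no  _ = μ t

  lam-low : ∀ {t} → t ≤ a → lamA t ≡ 2 ^ t
  lam-low {t} t≤a with t ≤? a
  ... | yes _ = refl
  ... | no t≰a = contradiction t≤a t≰a

  lam-high : ∀ {t} → a < t → lamA t ≡ 2 ^ a * 3 ^ (t ∸ a)
  lam-high {t} a<t with t ≤? a
  ... | yes t≤a = contradiction t≤a (<⇒≱ a<t)
  ... | no  _   = refl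

  μ-in : ∀ {t} → t ≤ a + a → μ t ≡ lamA t
  μ-in {t} t≤ with t ≤? a + a
  ... | yes _ = refl
  ... | no t≰ = contradiction t≤ t≰

  μ-out : ∀ {t} → a + a < t → μ t ≡ 0
  μ-out {t} <t with t ≤? a + a
  ... | yes t≤ = contradiction t≤ (<⇒≱ <t)
  ... | no  _  = refl

  ν-low : ∀ {t} → t ≤ a → ν t ≡ 0
  ν-low {t} t≤a with t ≤? a
  ... | yes _ = refl
  ... | no t≰a = contradiction t≤a t≰a

  ν-high : ∀ {t} → a < t → ν t ≡ μ t
  ν-high {t} a<t with t ≤? a
  ... | yes t≤a = contradiction t≤a (<⇒≱ a<t)
  ... | no  _   = refl

  ν-out : ∀ {t} → a + a < t → ν t ≡ 0
  ν-out {t} <t with t ≤? a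
  ... | yes _ = refl
  ... | no  _ = μ-out <t

  μ≤lamA : ∀ t → μ t ≤ lamA t
  μ≤lamA t with t ≤? a + a
  ... | yes _ = ≤-refl
  ... | no  _ = z≤n

  -- Below the threshold μ is the geometric sequence 2^t; above it, it is ν.
  μ≤pow2+ν : ∀ t → μ t ≤ 2 ^ t + ν t
  μ≤pow2+ν t = bySide (t ≤? a)
    where
    bySide : Dec (t ≤ a) → μ t ≤ 2 ^ t + ν t
    bySide (yes t≤a) = ≤-trans (μ≤lamA t) (≤-trans (≤-reflexive (lam-low t≤a)) (m≤m+n _ _))
    bySide (no  t≰a) = ≤-trans (≤-reflexive (sym (ν-high (≰⇒> t≰a)))) (m≤n+m _ _)

  -- Above the threshold,  X = a + b  and  λ(X) = 2^a 3^b = 2^(a-b) 6^b.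
  lam-factor-high : ∀ {X} → a < X → X ≤ a + a → ∃[ y ] ∃[ b ] (X ≡ 2 * b + y × lamA X ≡ 2 ^ y * 6 ^ b)
  lam-factor-high {X} a<X X≤ = y , b , X≡ , lam≡
    where
    b y : ℕ
    b = X ∸ a
    y = a ∸ b
    b≤a : b ≤ a
    b≤a = +-cancelˡ-≤ a b a (≤-trans (≤-reflexive (m+[n∸m]≡n (<⇒≤ a<X))) X≤)
    a≡ : a ≡ y + b
    a≡ = sym (m∸n+n≡m b≤a)
    X≡ : X ≡ 2 * b + y
    X≡ = begin
      X         ≡⟨ m+[n∸m]≡n (<⇒≤ a<X) ⟨
      a + b     ≡⟨ cong (_+ b) a≡ ⟩
      y + b + b ≡⟨ regroup y b ⟩
      2 * b + y ∎
      where open ≡-Reasoning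
            regroup : ∀ y b → y + b + b ≡ 2 * b + y
            regroup = solve-∀
    lam≡ : lamA X ≡ 2 ^ y * 6 ^ b
    lam≡ = begin
      lamA X                  ≡⟨ lam-high a<X ⟩
      2 ^ a * 3 ^ b           ≡⟨ cong (λ k → 2 ^ k * 3 ^ b) a≡ ⟩
      2 ^ (y + b) * 3 ^ b     ≡⟨ cong (_* 3 ^ b) (^-distribˡ-+-* 2 y b) ⟩
      2 ^ y * 2 ^ b * 3 ^ b   ≡⟨ *-assoc (2 ^ y) (2 ^ b) (3 ^ b) ⟩
      2 ^ y * (2 ^ b * 3 ^ b) ≡⟨ cong (2 ^ y *_) (pow-mul 2 3 b) ⟨
      2 ^ y * 6 ^ b           ∎
      where open ≡-Reasoning

  lam-factor : ∀ X → X ≤ a + a → ∃[ y ] ∃[ b ] (X ≡ 2 * b + y × lamA X ≡ 2 ^ y * 6 ^ b)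
  lam-factor X X≤ = bySide (X ≤? a)
    where
    bySide : Dec (X ≤ a) → ∃[ y ] ∃[ b ] (X ≡ 2 * b + y × lamA X ≡ 2 ^ y * 6 ^ b)
    bySide (yes X≤a) = X , 0 , refl , trans (lam-low X≤a) (sym (*-identityʳ (2 ^ X)))
    bySide (no  X≰a) = lam-factor-high (≰⇒> X≰a) X≤

  lam≤2H : ∀ X → X ≤ a + a → lamA X ≤ 2 * H X
  lam≤2H X X≤ with lam-factor X X≤
  ... | y , b , refl , lam≡ = begin
    lamA (2 * b + y)  ≡⟨ lam≡ ⟩
    2 ^ y * 6 ^ b     ≤⟨ *-monoˡ-≤ (6 ^ b) (pow2≤2H y) ⟩
    2 * H y * 6 ^ b   ≡⟨ swap (H y) (6 ^ b) ⟩
    2 * (6 ^ b * H y) ≡⟨ cong (2 *_) (H-2* b y) ⟨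
    2 * H (2 * b + y) ∎
    where open ≤-Reasoning
          swap : ∀ p q → 2 * p * q ≡ 2 * (q * p)
          swap = solve-∀

  lam-sq : ∀ X → X ≤ a + a → lamA X * lamA X ≤ 6 ^ X
  lam-sq X X≤ with lam-factor X X≤
  ... | y , b , refl , lam≡ = begin
    lamA (2 * b + y) * lamA (2 * b + y) ≡⟨ cong₂ _*_ lam≡ lam≡ ⟩
    2 ^ y * 6 ^ b * (2 ^ y * 6 ^ b)     ≡⟨ shuffle (2 ^ y) (6 ^ b) ⟩
    (2 ^ y * 2 ^ y) * (6 ^ b * 6 ^ b)   ≡⟨ cong₂ _*_ (pow-mul 2 2 y) (^-distribˡ-+-* 6 b b) ⟨
    4 ^ y * 6 ^ (b + b)                 ≤⟨ *-monoˡ-≤ (6 ^ (b + b)) (^-monoˡ-≤ y (m≤m+n 4 2)) ⟩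
    6 ^ y * 6 ^ (b + b)                 ≡⟨ ^-distribˡ-+-* 6 y (b + b) ⟨
    6 ^ (y + (b + b))                   ≡⟨ cong (6 ^_) (regroup y b) ⟩
    6 ^ (2 * b + y)                     ∎
    where open ≤-Reasoning
          shuffle : ∀ p q → p * q * (p * q) ≡ (p * p) * (q * q)
          shuffle = solve-∀
          regroup : ∀ y b → y + (b + b) ≡ 2 * b + y
          regroup = solve-∀

  μ≤2H : ∀ X → μ X ≤ 2 * H X
  μ≤2H X with X ≤? a + a
  ... | yes X≤ = lam≤2H X X≤
  ... | no  _  = z≤n

  ν≤μ : ∀ t → ν t ≤ μ t
  ν≤μ t with t ≤? a
  ... | yes _ = z≤n
  ... | no  _ = ≤-refl

  ν≤2H : ∀ X → ν X ≤ 2 * H X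
  ν≤2H X = ≤-trans (ν≤μ X) (μ≤2H X)

  ν-above : ∀ {t} → a < t → t ≤ a + a → ν t ≡ 2 ^ a * 3 ^ (t ∸ a)
  ν-above a<t t≤ = trans (ν-high a<t) (trans (μ-in t≤) (lam-high a<t))

  ν-growth : ∀ t → suc t ≤ a + a → 3 * ν t ≤ ν (suc t)
  ν-growth t st≤ = bySide (t ≤? a)
    where
    bySide : Dec (t ≤ a) → 3 * ν t ≤ ν (suc t)
    bySide (yes t≤a) = ≤-trans (≤-reflexive (cong (3 *_) (ν-low t≤a))) z≤n
    bySide (no  t≰a) = ≤-reflexive (begin
      3 * ν t                   ≡⟨ cong (3 *_) (ν-above a<t (<⇒≤ st≤)) ⟩
      3 * (2 ^ a * 3 ^ (t ∸ a)) ≡⟨ swap (2 ^ a) (3 ^ (t ∸ a)) ⟩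
      2 ^ a * 3 ^ suc (t ∸ a)   ≡⟨ cong (λ k → 2 ^ a * 3 ^ k) (+-∸-assoc 1 (<⇒≤ a<t)) ⟨
      2 ^ a * 3 ^ (suc t ∸ a)   ≡⟨ ν-above (m<n⇒m<1+n a<t) st≤ ⟨
      ν (suc t)                 ∎)
      where open ≡-Reasoning
            a<t : a < t
            a<t = ≰⇒> t≰a
            swap : ∀ x y → 3 * (x * y) ≡ x * (3 * y)
            swap = solve-∀

  -- One step of the convolution recursion for a sequence growing by the factor 3.
  geometric-step : ∀ A B C → 3 * A ≤ B → 3 * B ≤ C → C + (B + 6 * (4 * A)) ≤ 4 * C
  geometric-step A B C 3A≤B 3B≤C = begin
    C + (B + 6 * (4 * A)) ≡⟨ cong (λ z → C + (B + z)) (regroup A) ⟩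
    C + (B + 8 * (3 * A)) ≤⟨ +-monoʳ-≤ C (+-monoʳ-≤ B (*-monoʳ-≤ 8 3A≤B)) ⟩
    C + (B + 8 * B)       ≡⟨ cong (C +_) (nine B) ⟩
    C + 3 * (3 * B)       ≤⟨ +-monoʳ-≤ C (*-monoʳ-≤ 3 3B≤C) ⟩
    C + 3 * C             ≡⟨ four C ⟩
    4 * C                 ∎
    where open ≤-Reasoning
          regroup : ∀ A → 6 * (4 * A) ≡ 8 * (3 * A)
          regroup = solve-∀
          nine : ∀ B → B + 8 * B ≡ 3 * (3 * B)
          nine = solve-∀
          four : ∀ C → C + 3 * C ≡ 4 * C
          four = solve-∀

  conv-ν-low : ∀ X → X ≤ a + a → conv ν X ≤ 4 * ν X
  conv-ν-low zero          _ rewrite ν-low {0} z≤n = z≤n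
  conv-ν-low (suc zero)    _ rewrite ν-low {0} z≤n =
    ≤-trans (≤-reflexive (trans (+-identityʳ _) (*-identityʳ (ν 1)))) (m≤n*m (ν 1) 4)
  conv-ν-low (suc (suc X)) X≤ rewrite conv-step ν X =
    ≤-trans (+-monoʳ-≤ (ν (suc (suc X))) (+-monoʳ-≤ (ν (suc X)) (*-monoʳ-≤ 6 (conv-ν-low X X≤′))))
            (geometric-step (ν X) (ν (suc X)) (ν (suc (suc X))) (ν-growth X sX≤) (ν-growth (suc X) X≤))
    where sX≤ : suc X ≤ a + a
          sX≤ = ≤-trans (n≤1+n (suc X)) X≤
          X≤′ : X ≤ a + a
          X≤′ = ≤-trans (n≤1+n X) sX≤

  conv-ν-within : ∀ X → X ≤ a + a → conv ν X ≤ 8 * H X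
  conv-ν-within X X≤ =
    ≤-trans (conv-ν-low X X≤) (≤-trans (*-monoʳ-≤ 4 (ν≤2H X)) (≤-reflexive (sym (*-assoc 4 2 (H X)))))

  conv-ν : ∀ X → conv ν X ≤ 10 * H X
  conv-ν-beyond : ∀ X → a + a < X → conv ν X ≤ 10 * H X

  conv-ν X with X ≤? a + a
  ... | yes X≤ = ≤-trans (conv-ν-within X X≤) (*-monoˡ-≤ (H X) (m≤m+n 8 2))
  ... | no  X≰ = conv-ν-beyond X (≰⇒> X≰)

  -- Beyond h, ν vanishes and the convolution only grows like H.
  conv-ν-beyond (suc zero) <X rewrite ν-out <X | ν-low {0} z≤n = z≤n
  conv-ν-beyond (suc (suc Y)) <X rewrite conv-step ν Y | ν-out <X = bySide (suc Y ≤? a + a)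
    where
    bySide : Dec (suc Y ≤ a + a) → ν (suc Y) + 6 * conv ν Y ≤ 10 * (6 * H Y)
    bySide (yes sY≤) = begin
      ν (suc Y) + 6 * conv ν Y        ≤⟨ +-mono-≤ (ν≤2H (suc Y)) (*-monoʳ-≤ 6 (conv-ν-within Y (≤-trans (n≤1+n Y) sY≤))) ⟩
      2 * H (suc Y) + 6 * (8 * H Y)   ≤⟨ +-monoˡ-≤ (6 * (8 * H Y)) (*-monoʳ-≤ 2 (H-suc (suc Y))) ⟩
      2 * (6 * H Y) + 6 * (8 * H Y)   ≡⟨ sixty (H Y) ⟩
      10 * (6 * H Y)                  ∎
      where open ≤-Reasoning
            sixty : ∀ z → 2 * (6 * z) + 6 * (8 * z) ≡ 10 * (6 * z)
            sixty = solve-∀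
    bySide (no sY≰) rewrite ν-out (≰⇒> sY≰) = ≤-trans (*-monoʳ-≤ 6 (conv-ν Y)) (≤-reflexive (swap (H Y)))
      where swap : ∀ z → 6 * (10 * z) ≡ 10 * (6 * z)
            swap = solve-∀

  conv-μ : ∀ X → conv μ X ≤ 19 * H X
  conv-μ X = begin
    conv μ X                                       ≤⟨ sumBelow-mono (suc X) split ⟩
    sumBelow (suc X) (λ t → 2 ^ t * H (X ∸ t) + ν t * H (X ∸ t))
      ≡⟨ sumBelow-add (suc X) (λ t → 2 ^ t * H (X ∸ t)) (λ t → ν t * H (X ∸ t)) ⟩
    conv (2 ^_) X + conv ν X                       ≤⟨ +-mono-≤ (conv-pow2 X) (conv-ν X) ⟩
    9 * H X + 10 * H X                             ≡⟨ *-distribʳ-+ (H X) 9 10 ⟨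
    19 * H X                                       ∎
    where
    open ≤-Reasoning
    split : ∀ t → t < suc X → μ t * H (X ∸ t) ≤ 2 ^ t * H (X ∸ t) + ν t * H (X ∸ t)
    split t _ = ≤-trans (*-monoˡ-≤ (H (X ∸ t)) (μ≤pow2+ν t)) (≤-reflexive (*-distribʳ-+ (H (X ∸ t)) (2 ^ t) (ν t)))

  μ-zero : μ 0 ≡ 1
  μ-zero = trans (μ-in z≤n) (lam-low z≤n)

  lam-from-threshold : ∀ {t} → a ≤ t → lamA t ≡ 2 ^ a * 3 ^ (t ∸ a)
  lam-from-threshold {t} a≤t = bySide (t ≤? a)
    where
    bySide : Dec (t ≤ a) → lamA t ≡ 2 ^ a * 3 ^ (t ∸ a)
    bySide (yes t≤a) with ≤-antisym t≤a a≤t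
    ... | refl = trans (lam-low t≤a) (sym (trans (cong (λ k → 2 ^ t * 3 ^ k) (n∸n≡0 t)) (*-identityʳ (2 ^ t))))
    bySide (no  t≰a) = lam-high (≰⇒> t≰a)

  lam-step-low : ∀ {t} → suc t ≤ a → lamA (suc t) ≡ 2 * lamA t
  lam-step-low {t} st≤a = trans (lam-low st≤a) (cong (2 *_) (sym (lam-low (<⇒≤ st≤a))))

  lam-step-high : ∀ {t} → a ≤ t → lamA (suc t) ≡ 3 * lamA t
  lam-step-high {t} a≤t = begin
    lamA (suc t)               ≡⟨ lam-from-threshold (m≤n⇒m≤1+n a≤t) ⟩
    2 ^ a * 3 ^ (suc t ∸ a)    ≡⟨ cong (λ k → 2 ^ a * 3 ^ k) (+-∸-assoc 1 a≤t) ⟩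
    2 ^ a * (3 * 3 ^ (t ∸ a))  ≡⟨ swap (2 ^ a) (3 ^ (t ∸ a)) ⟩
    3 * (2 ^ a * 3 ^ (t ∸ a))  ≡⟨ cong (3 *_) (lam-from-threshold a≤t) ⟨
    3 * lamA t                 ∎
    where open ≡-Reasoning
          swap : ∀ x y → x * (3 * y) ≡ 3 * (x * y)
          swap = solve-∀

  lam-double : ∀ X → 2 * lamA X ≤ lamA (suc X)
  lam-double X = bySide (suc X ≤? a)
    where
    bySide : Dec (suc X ≤ a) → 2 * lamA X ≤ lamA (suc X)
    bySide (yes sX≤a) = ≤-reflexive (sym (lam-step-low sX≤a))
    bySide (no  sX≰a) = ≤-trans (*-monoˡ-≤ (lamA X) (m≤m+n 2 1)) (≤-reflexive (sym (lam-step-high (≤-pred (≰⇒> sX≰a)))))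

  μ-double : ∀ X → suc X ≤ a + a → 2 * μ X ≤ μ (suc X)
  μ-double X sX≤ rewrite μ-in (<⇒≤ sX≤) | μ-in sX≤ = lam-double X

  -- Since μ at least doubles, its partial sums are dominated by twice the last term.
  sumμ-low : ∀ X → X ≤ a + a → sumBelow (suc X) μ + 1 ≤ 2 * μ X
  sumμ-low zero    _ rewrite μ-zero = ≤-refl
  sumμ-low (suc X) sX≤ = begin
    μ (suc X) + sumBelow (suc X) μ + 1   ≡⟨ +-assoc (μ (suc X)) (sumBelow (suc X) μ) 1 ⟩
    μ (suc X) + (sumBelow (suc X) μ + 1) ≤⟨ +-monoʳ-≤ (μ (suc X)) (sumμ-low X (<⇒≤ sX≤)) ⟩
    μ (suc X) + 2 * μ X                  ≤⟨ +-monoʳ-≤ (μ (suc X)) (μ-double X sX≤) ⟩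
    μ (suc X) + μ (suc X)                ≡⟨ cong (μ (suc X) +_) (+-identityʳ (μ (suc X))) ⟨
    2 * μ (suc X)                        ∎
    where open ≤-Reasoning

  sumμ-sq-within : ∀ X → X ≤ a + a → sumBelow (suc X) μ * sumBelow (suc X) μ ≤ 4 * 6 ^ X
  sumμ-sq-within X X≤ = begin
    sumBelow (suc X) μ * sumBelow (suc X) μ ≤⟨ *-mono-≤ bound bound ⟩
    2 * μ X * (2 * μ X)                     ≡⟨ shuffle (μ X) ⟩
    4 * (μ X * μ X)                         ≡⟨ cong (λ z → 4 * (z * z)) (μ-in X≤) ⟩
    4 * (lamA X * lamA X)                   ≤⟨ *-monoʳ-≤ 4 (lam-sq X X≤) ⟩
    4 * 6 ^ X                               ∎
    where open ≤-Reasoning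
          bound : sumBelow (suc X) μ ≤ 2 * μ X
          bound = ≤-trans (m≤m+n _ 1) (sumμ-low X X≤)
          shuffle : ∀ z → 2 * z * (2 * z) ≡ 4 * (z * z)
          shuffle = solve-∀

  sumμ-sq : ∀ X → sumBelow (suc X) μ * sumBelow (suc X) μ ≤ 4 * 6 ^ X
  sumμ-sq X = bySide (X ≤? a + a)
    where
    bySide : Dec (X ≤ a + a) → sumBelow (suc X) μ * sumBelow (suc X) μ ≤ 4 * 6 ^ X
    bySide (yes X≤) = sumμ-sq-within X X≤
    bySide (no  X≰) rewrite sumBelow-vanish (suc (a + a)) (suc X) μ (s≤s (<⇒≤ (≰⇒> X≰))) (λ t h<t → μ-out h<t) =
      ≤-trans (sumμ-sq-within (a + a) ≤-refl) (*-monoʳ-≤ 4 (^-monoʳ-≤ 6 (<⇒≤ (≰⇒> X≰))))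

  lam-agrees : ∀ h → h / 2 ≡ a → ∀ t → lam h t ≡ lamA t
  lam-agrees h h/2≡ t rewrite h/2≡ = bySide (t ≤? a)
    where
    bySide : Dec (t ≤ a) → (if t ≤ᵇ a then 2 ^ t else 2 ^ a * 3 ^ (t ∸ a)) ≡ lamA t
    bySide (yes t≤a) = trans (if-true (t ≤ᵇ a) (≤⇒≤ᵇ t≤a)) (sym (lam-low t≤a))
    bySide (no  t≰a) = trans (if-false (t ≤ᵇ a) (λ le → t≰a (≤ᵇ⇒≤ t a le))) (sym (lam-high (≰⇒> t≰a)))

  μ≤lam : ∀ h → h / 2 ≡ a → ∀ t → μ t ≤ lam h t
  μ≤lam h h/2≡ t = ≤-trans (μ≤lamA t) (≤-reflexive (sym (lam-agrees h h/2≡ t)))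

  wt : List ℕ → ℕ
  wt []          = 0
  wt (t ∷ [])    = μ t
  wt (t ∷ e ∷ r) = μ t * (ce e * wt r)

  prefixWt : List ℕ → ℕ
  prefixWt []          = 1
  prefixWt (x ∷ [])    = 1
  prefixWt (t ∷ e ∷ s) = μ t * (ce e * prefixWt s)

  wt-++ : ∀ ℓ (s rest : List ℕ) → length s ≡ 2 * ℓ → wt (s ++ rest) ≡ prefixWt s * wt rest
  wt-++ zero    []          rest _   = sym (+-identityʳ (wt rest))
  wt-++ (suc ℓ) (x ∷ [])    rest len = contradiction len (1≢2*suc ℓ)
  wt-++ (suc ℓ) (t ∷ e ∷ s) rest len =
    trans (cong (λ z → μ t * (ce e * z)) (wt-++ ℓ s rest (even-length-tail {r = s} ℓ len))) (regroup (μ t) (ce e) (prefixWt s) (wt rest))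
    where regroup : ∀ p q r w → p * (q * (r * w)) ≡ p * (q * r) * w
          regroup = solve-∀

  -- (2 ce(e))² ≤ 9 · (2^e)²: an expander segment is worth at most  (3/2) · 2^e.
  ce-sq : ∀ e → 2 * ce e * (2 * ce e) ≤ 9 * (2 ^ e * 2 ^ e)
  ce-sq zero    = s≤s (s≤s (s≤s (s≤s z≤n)))
  ce-sq (suc e) = ≤-reflexive (regroup (2 ^ e))
    where regroup : ∀ p → 2 * (3 * p) * (2 * (3 * p)) ≡ 9 * (2 * p * (2 * p))
          regroup = solve-∀

  -- The prefix weight is at most  (3/2)^ℓ ∏ λ(t_{2i-1}) 2^{t_{2i}}, squared to stay in ℕ.
  prefixWt-sq : ∀ h → h / 2 ≡ a → ∀ ℓ (s : List ℕ) → length s ≡ 2 * ℓ →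
                prefixWt s * prefixWt s * 4 ^ ℓ ≤ 9 ^ ℓ * (prodTerm h s * prodTerm h s)
  prefixWt-sq h h/2≡ zero    []          _   = ≤-refl
  prefixWt-sq h h/2≡ (suc ℓ) (x ∷ [])    len = contradiction len (1≢2*suc ℓ)
  prefixWt-sq h h/2≡ (suc ℓ) (t ∷ e ∷ s) len = begin
    μ t * (ce e * prefixWt s) * (μ t * (ce e * prefixWt s)) * (4 * 4 ^ ℓ)
      ≡⟨ regroup₁ (μ t) (ce e) (prefixWt s) (4 ^ ℓ) ⟩
    μ t * μ t * (2 * ce e * (2 * ce e)) * (prefixWt s * prefixWt s * 4 ^ ℓ)
      ≤⟨ *-mono-≤ (*-mono-≤ (*-mono-≤ (μ≤lam h h/2≡ t) (μ≤lam h h/2≡ t)) (ce-sq e))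
                  (prefixWt-sq h h/2≡ ℓ s (even-length-tail {r = s} ℓ len)) ⟩
    lam h t * lam h t * (9 * (2 ^ e * 2 ^ e)) * (9 ^ ℓ * (prodTerm h s * prodTerm h s))
      ≡⟨ regroup₂ (lam h t) (2 ^ e) (9 ^ ℓ) (prodTerm h s) ⟩
    9 * 9 ^ ℓ * (lam h t * 2 ^ e * prodTerm h s * (lam h t * 2 ^ e * prodTerm h s)) ∎
    where
    open ≤-Reasoning
    regroup₁ : ∀ p q w f → p * (q * w) * (p * (q * w)) * (4 * f) ≡ p * p * (2 * q * (2 * q)) * (w * w * f)
    regroup₁ = solve-∀
    regroup₂ : ∀ p q g r → p * p * (9 * (q * q)) * (g * (r * r)) ≡ 9 * g * (p * q * r * (p * q * r))
    regroup₂ = solve-∀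

-- Lengths are measured in units of 2 edges, so a tree segment
-- of pattern entry t costs t, and an expander segment of e edges together with its two connecting
-- paths costs  half · (e + 2)  where  c = 2 · half.
module PatternSum (a half : ℕ) (1≤half : 1 ≤ half) where
  open TreeWeight a

  e≤half*e : ∀ e → e ≤ half * e
  e≤half*e e = ≤-trans (≤-reflexive (sym (*-identityˡ e))) (*-monoˡ-≤ e 1≤half)

  -- Σ_e ce(e) · H(Y - half·e) ≤ 27 · H(Y): the expander weights are geometric of ratio 2 < √6.
  expander-sum : ∀ n Y → sumBelow n (λ e → onlyIf (half * e ≤? Y) (ce e * H (Y ∸ half * e))) ≤ 27 * H Y
  expander-sum n Y = begin
    sumBelow n (λ e → onlyIf (half * e ≤? Y) (ce e * H (Y ∸ half * e)))
      ≤⟨ sumBelow-mono n (λ e _ → termwise e (half * e ≤? Y)) ⟩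
    sumBelow n (λ e → onlyIf (e ≤? Y) (3 * (2 ^ e * H (Y ∸ e))))
      ≤⟨ sumBelow-truncate n Y (λ e → 3 * (2 ^ e * H (Y ∸ e))) ⟩
    sumBelow (suc Y) (λ e → 3 * (2 ^ e * H (Y ∸ e)))
      ≡⟨ sumBelow-scale (suc Y) 3 (λ e → 2 ^ e * H (Y ∸ e)) ⟩
    3 * conv (2 ^_) Y
      ≤⟨ *-monoʳ-≤ 3 (conv-pow2 Y) ⟩
    3 * (9 * H Y)
      ≡⟨ *-assoc 3 9 (H Y) ⟨
    27 * H Y ∎
    where
    open ≤-Reasoning
    termwise : ∀ e → (d : Dec (half * e ≤ Y)) →
               onlyIf d (ce e * H (Y ∸ half * e)) ≤ onlyIf (e ≤? Y) (3 * (2 ^ e * H (Y ∸ e)))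
    termwise e (no _)  = z≤n
    termwise e (yes q) rewrite onlyIf-yes (e ≤? Y) (3 * (2 ^ e * H (Y ∸ e))) (≤-trans (e≤half*e e) q) =
      ≤-trans (*-mono-≤ (ce≤ e) (H-mono (∸-monoʳ-≤ Y (e≤half*e e)))) (≤-reflexive (*-assoc 3 (2 ^ e) (H (Y ∸ e))))

  -- The cost of a block: a tree segment t, a connecting path up, e subdivided edges, a connecting path down.
  cost : ℕ → ℕ → ℕ
  cost t e = t + half * (e + 2)

  withBlock : ℕ → ℕ → List ℕ → List ℕ
  withBlock t e r = t ∷ e ∷ r

  patterns : ℕ → ℕ → List (List ℕ)
  -- The patterns that start with the block (t, e) and continue with m blocks; the block is only kept
  -- when the budget leaves room for the remaining blocks, each of which costs at least 2·half.
  block : ℕ → ℕ → ℕ → ℕ → List (List ℕ)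

  patterns zero    β = map [_] (downFrom (suc β))
  patterns (suc m) β = concatMap (λ t → concatMap (block m β t) (downFrom (suc β))) (downFrom (suc β))

  block m β t e = listIf (cost t e + 2 * half * m ≤? β) (map (withBlock t e) (patterns m (β ∸ cost t e)))

  totalWt : List (List ℕ) → ℕ
  totalWt ps = sum (map wt ps)

  totalWt-++ : ∀ ps qs → totalWt (ps ++ qs) ≡ totalWt ps + totalWt qs
  totalWt-++ ps qs = trans (cong sum (map-++ wt ps qs)) (sum-++ (map wt ps) (map wt qs))

  totalWt-concatMap : ∀ n (g : ℕ → List (List ℕ)) → totalWt (concatMap g (downFrom n)) ≡ sumBelow n (λ t → totalWt (g t))
  totalWt-concatMap zero    g = refl
  totalWt-concatMap (suc n) g = trans (totalWt-++ (g n) (concatMap g (downFrom n))) (cong (totalWt (g n) +_) (totalWt-concatMap n g))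

  totalWt-prefix : ∀ t e ps → totalWt (map (withBlock t e) ps) ≡ μ t * (ce e * totalWt ps)
  totalWt-prefix t e []       = sym (trans (cong (μ t *_) (*-zeroʳ (ce e))) (*-zeroʳ (μ t)))
  totalWt-prefix t e (r ∷ ps) rewrite totalWt-prefix t e ps = distrib (μ t) (ce e) (wt r) (totalWt ps)
    where distrib : ∀ p q x y → p * (q * x) + p * (q * y) ≡ p * (q * (x + y))
          distrib = solve-∀

  totalWt-singletons : ∀ n → totalWt (map [_] (downFrom n)) ≡ sumBelow n μ
  totalWt-singletons zero    = refl
  totalWt-singletons (suc n) = cong (μ n +_) (totalWt-singletons n)

  block-budget : ∀ m β t e → cost t e + 2 * half * m ≤ β →
                 t ≤ β ∸ 2 * half * suc m × half * e ≤ (β ∸ 2 * half * suc m) ∸ t ×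
                 (β ∸ cost t e) ∸ 2 * half * m ≡ ((β ∸ 2 * half * suc m) ∸ t) ∸ half * e
  block-budget m β t e fits with m≤n⇒∃[o]m+o≡n fits
  ... | d , refl = ≤-trans (m≤m+n t (half * e + d)) (≤-reflexive (sym W≡)) ,
                   ≤-trans (m≤m+n (half * e) d) (≤-reflexive (sym W∸t≡)) ,
                   trans left (sym right)
    where
    used : ℕ
    used = cost t e + 2 * half * m
    β≡ : used + d ≡ (t + (half * e + d)) + 2 * half * suc m
    β≡ = regroup t e d m half
      where regroup : ∀ t e d m half → t + half * (e + 2) + 2 * half * m + d ≡ (t + (half * e + d)) + 2 * half * suc m
            regroup = solve-∀
    W≡ : (used + d) ∸ 2 * half * suc m ≡ t + (half * e + d)
    W≡ = trans (cong (_∸ 2 * half * suc m) β≡) (m+n∸n≡m _ (2 * half * suc m))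
    W∸t≡ : (used + d) ∸ 2 * half * suc m ∸ t ≡ half * e + d
    W∸t≡ = trans (cong (_∸ t) W≡) (m+n∸m≡n t (half * e + d))
    left : (used + d) ∸ cost t e ∸ 2 * half * m ≡ d
    left = trans (∸-+-assoc (used + d) (cost t e) (2 * half * m)) (m+n∸m≡n used d)
    right : (used + d) ∸ 2 * half * suc m ∸ t ∸ half * e ≡ d
    right = trans (cong (_∸ half * e) W∸t≡) (m+n∸m≡n (half * e) d)

  weightBound : ℕ → ℕ
  weightBound m = 19 * 513 ^ m

  PatternBound : ℕ → Set
  PatternBound m = ∀ β → totalWt (patterns m β) ≤ weightBound m * H (β ∸ 2 * half * m)

  block-weight : ∀ m β t e → PatternBound m →
                 totalWt (block m β t e) ≤ μ t * (weightBound m * onlyIf (half * e ≤? (β ∸ 2 * half * suc m) ∸ t)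
                                                                        (ce e * H (((β ∸ 2 * half * suc m) ∸ t) ∸ half * e)))
  block-weight m β t e ih with cost t e + 2 * half * m ≤? β
  ... | no  _    = z≤n
  ... | yes fits with block-budget m β t e fits
  ...   | _ , e≤ , rest≡ rewrite onlyIf-yes (half * e ≤? (β ∸ 2 * half * suc m) ∸ t) (ce e * H (((β ∸ 2 * half * suc m) ∸ t) ∸ half * e)) e≤ = begin
    totalWt (map (withBlock t e) (patterns m (β ∸ cost t e)))
      ≡⟨ totalWt-prefix t e (patterns m (β ∸ cost t e)) ⟩
    μ t * (ce e * totalWt (patterns m (β ∸ cost t e)))
      ≤⟨ *-monoʳ-≤ (μ t) (*-monoʳ-≤ (ce e) (ih (β ∸ cost t e))) ⟩
    μ t * (ce e * (weightBound m * H ((β ∸ cost t e) ∸ 2 * half * m)))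
      ≡⟨ cong (λ z → μ t * (ce e * (weightBound m * H z))) rest≡ ⟩
    μ t * (ce e * (weightBound m * H (((β ∸ 2 * half * suc m) ∸ t) ∸ half * e)))
      ≡⟨ cong (μ t *_) (swap (ce e) (weightBound m) _) ⟩
    μ t * (weightBound m * (ce e * H (((β ∸ 2 * half * suc m) ∸ t) ∸ half * e))) ∎
    where open ≤-Reasoning
          swap : ∀ x k y → x * (k * y) ≡ k * (x * y)
          swap = solve-∀

  block-beyond : ∀ m β t e → ¬ t ≤ β ∸ 2 * half * suc m → totalWt (block m β t e) ≡ 0
  block-beyond m β t e t≰W with cost t e + 2 * half * m ≤? β
  ... | no  _    = refl
  ... | yes fits = contradiction (proj₁ (block-budget m β t e fits)) t≰W

  block-row : ∀ m β t → PatternBound m →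
              sumBelow (suc β) (λ e → totalWt (block m β t e))
                ≤ onlyIf (t ≤? β ∸ 2 * half * suc m) (μ t * (weightBound m * 27 * H ((β ∸ 2 * half * suc m) ∸ t)))
  block-row m β t ih with t ≤? β ∸ 2 * half * suc m
  ... | no  t≰W = ≤-reflexive (trans (sumBelow-cong (suc β) (λ e _ → block-beyond m β t e t≰W)) (sumBelow-0 (suc β)))
  ... | yes _   = begin
    sumBelow (suc β) (λ e → totalWt (block m β t e))
      ≤⟨ sumBelow-mono (suc β) (λ e _ → block-weight m β t e ih) ⟩
    sumBelow (suc β) (λ e → μ t * (weightBound m * E e))
      ≡⟨ sumBelow-scale (suc β) (μ t) (λ e → weightBound m * E e) ⟩
    μ t * sumBelow (suc β) (λ e → weightBound m * E e)
      ≡⟨ cong (μ t *_) (sumBelow-scale (suc β) (weightBound m) E) ⟩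
    μ t * (weightBound m * sumBelow (suc β) E)
      ≤⟨ *-monoʳ-≤ (μ t) (*-monoʳ-≤ (weightBound m) (expander-sum (suc β) Y)) ⟩
    μ t * (weightBound m * (27 * H Y))
      ≡⟨ cong (μ t *_) (*-assoc (weightBound m) 27 (H Y)) ⟨
    μ t * (weightBound m * 27 * H Y) ∎
    where
    open ≤-Reasoning
    Y : ℕ
    Y = (β ∸ 2 * half * suc m) ∸ t
    E : ℕ → ℕ
    E e = onlyIf (half * e ≤? Y) (ce e * H (Y ∸ half * e))

  -- The main summation estimate, by induction on the number of blocks: with no block the sum is a
  -- partial sum of μ, and each block contributes  27 · conv μ ≤ 27 · 19 H.
  patterns-bound : ∀ m → PatternBound m
  patterns-bound zero β rewrite totalWt-singletons (suc β) | *-zeroʳ (2 * half) = begin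
    sumBelow (suc β) μ                       ≤⟨ sumBelow-mono (suc β) (λ t _ → m≤m*n (μ t) (H (β ∸ t)) {{>-nonZero (H-pos (β ∸ t))}}) ⟩
    conv μ β                                 ≤⟨ conv-μ β ⟩
    19 * H β                                 ≡⟨ cong (_* H β) (+-identityʳ 19) ⟨
    weightBound zero * H β                   ∎
    where open ≤-Reasoning
  patterns-bound (suc m) β = begin
    totalWt (patterns (suc m) β)
      ≡⟨ totalWt-concatMap (suc β) (λ t → concatMap (block m β t) (downFrom (suc β))) ⟩
    sumBelow (suc β) (λ t → totalWt (concatMap (block m β t) (downFrom (suc β))))
      ≡⟨ sumBelow-cong (suc β) (λ t _ → totalWt-concatMap (suc β) (block m β t)) ⟩
    sumBelow (suc β) (λ t → sumBelow (suc β) (λ e → totalWt (block m β t e)))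
      ≤⟨ sumBelow-mono (suc β) (λ t _ → block-row m β t (patterns-bound m)) ⟩
    sumBelow (suc β) (λ t → onlyIf (t ≤? W′) (μ t * (K * H (W′ ∸ t))))
      ≤⟨ sumBelow-truncate (suc β) W′ (λ t → μ t * (K * H (W′ ∸ t))) ⟩
    sumBelow (suc W′) (λ t → μ t * (K * H (W′ ∸ t)))
      ≡⟨ sumBelow-cong (suc W′) (λ t _ → swap (μ t) K (H (W′ ∸ t))) ⟩
    sumBelow (suc W′) (λ t → K * (μ t * H (W′ ∸ t)))
      ≡⟨ sumBelow-scale (suc W′) K (λ t → μ t * H (W′ ∸ t)) ⟩
    K * conv μ W′
      ≤⟨ *-monoʳ-≤ K (conv-μ W′) ⟩
    K * (19 * H W′)
      ≡⟨ regroup (513 ^ m) (H W′) ⟩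
    weightBound (suc m) * H W′ ∎
    where
    open ≤-Reasoning
    W′ K : ℕ
    W′ = β ∸ 2 * half * suc m
    K = weightBound m * 27
    swap : ∀ p k q → p * (k * q) ≡ k * (p * q)
    swap = solve-∀
    regroup : ∀ p q → 19 * p * 27 * (19 * q) ≡ 19 * (513 * p) * q
    regroup = solve-∀

  -- Squared form with the constant  C = 19 · 513 = 9747  of the theorem; for m = 0 the sharper
  -- bound on the partial sums of μ is needed.
  patterns-bound-sq : ∀ m β → totalWt (patterns m β) * totalWt (patterns m β) ≤ 4 * (9747 ^ m * 9747 ^ m) * 6 ^ (β ∸ 2 * half * m)
  patterns-bound-sq zero β rewrite totalWt-singletons (suc β) | *-zeroʳ (2 * half) = sumμ-sq β
  patterns-bound-sq (suc k) β = begin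
    totalWt (patterns (suc k) β) * totalWt (patterns (suc k) β)
      ≤⟨ *-mono-≤ (patterns-bound (suc k) β) (patterns-bound (suc k) β) ⟩
    19 * p * H Y * (19 * p * H Y)
      ≡⟨ regroup p (H Y) ⟩
    19 * p * (19 * p) * (H Y * H Y)
      ≤⟨ *-mono-≤ (*-mono-≤ (*-monoˡ-≤ p 19≤) (*-monoˡ-≤ p 19≤)) (H-sq Y) ⟩
    19 ^ suc k * p * (19 ^ suc k * p) * 6 ^ Y
      ≤⟨ *-monoˡ-≤ (6 ^ Y) (m≤n*m (19 ^ suc k * p * (19 ^ suc k * p)) 4) ⟩
    4 * (19 ^ suc k * p * (19 ^ suc k * p)) * 6 ^ Y
      ≡⟨ cong (λ z → 4 * (z * z) * 6 ^ Y) (pow-mul 19 513 (suc k)) ⟨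
    4 * (9747 ^ suc k * 9747 ^ suc k) * 6 ^ Y ∎
    where
    open ≤-Reasoning
    p Y : ℕ
    p = 513 ^ suc k
    Y = β ∸ 2 * half * suc k
    regroup : ∀ p q → 19 * p * q * (19 * p * q) ≡ 19 * p * (19 * p) * (q * q)
    regroup = solve-∀
    19≤ : 19 ≤ 19 ^ suc k
    19≤ = *-monoʳ-≤ 19 (m^n>0 19 k)

  halfLen : List ℕ → ℕ
  halfLen r = sumOdd r + half * sumEven2 r

  sumEven2-≥ : ∀ m r → length r ≡ 2 * m + 1 → 2 * m ≤ sumEven2 r
  sumEven2-≥ zero    r           _   = z≤n
  sumEven2-≥ (suc m) (x ∷ [])    len = contradiction len (1≢suc+1 _)
  sumEven2-≥ (suc m) (x ∷ y ∷ r) len =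
    ≤-trans (≤-reflexive (*-distribˡ-+ 2 1 m)) (+-mono-≤ (m≤n+m 2 y) (sumEven2-≥ m r (odd-length-tail {r = r} m len)))

  patterns-complete : ∀ m β r → length r ≡ 2 * m + 1 → halfLen r ≤ β → r ∈ patterns m β
  patterns-complete zero    β (t ∷ [])    _   fits = ∈-map⁺ [_] (∈-downFrom⁺ (s≤s (≤-trans (m≤m+n t _) fits)))
  patterns-complete zero    β (t ∷ _ ∷ _) len fits = contradiction (suc-injective len) (λ ())
  patterns-complete (suc m) β (t ∷ [])    len fits = contradiction len (1≢suc+1 _)
  patterns-complete (suc m) β (t ∷ e ∷ r) len fits =
    ∈-concatMap (∈-concatMap inBlock (∈-downFrom⁺ (s≤s e≤β))) (∈-downFrom⁺ (s≤s t≤β))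
    where
    len-r : length r ≡ 2 * m + 1
    len-r = odd-length-tail {r = r} m len
    split : cost t e + halfLen r ≤ β
    split = ≤-trans (≤-reflexive (regroup t e half (sumOdd r) (sumEven2 r))) fits
      where regroup : ∀ t e half x y → t + half * (e + 2) + (x + half * y) ≡ t + x + half * (e + 2 + y)
            regroup = solve-∀
    t≤β : t ≤ β
    t≤β = ≤-trans (m≤m+n t _) (≤-trans (m≤m+n (cost t e) _) split)
    e≤β : e ≤ β
    e≤β = ≤-trans (≤-trans (e≤half*e e) (*-monoʳ-≤ half (m≤m+n e 2)))
                  (≤-trans (m≤n+m _ t) (≤-trans (m≤m+n (cost t e) _) split))
    rest≥ : 2 * half * m ≤ halfLen r
    rest≥ = ≤-trans (≤-reflexive (swap half m)) (≤-trans (*-monoʳ-≤ half (sumEven2-≥ m r len-r)) (m≤n+m _ _))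
      where swap : ∀ half m → 2 * half * m ≡ half * (2 * m)
            swap = solve-∀
    fitsBlock : cost t e + 2 * half * m ≤ β
    fitsBlock = ≤-trans (+-monoʳ-≤ (cost t e) rest≥) split
    inBlock : (t ∷ e ∷ r) ∈ block m β t e
    inBlock rewrite listIf-yes (cost t e + 2 * half * m ≤? β) (map (withBlock t e) (patterns m (β ∸ cost t e))) fitsBlock =
      ∈-map⁺ (withBlock t e) (patterns-complete m (β ∸ cost t e) r len-r (m+n≤o⇒m≤o∸n (halfLen r) (≤-trans (≤-reflexive (+-comm (halfLen r) (cost t e))) split)))

replicate-+ : ∀ {A : Set} m n (x : A) → replicate (m + n) x ≡ replicate m x ++ replicate n x
replicate-+ zero    n x = refl
replicate-+ (suc m) n x = cong (x ∷_) (replicate-+ m n x)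

regions-drop : ∀ {N} (A B : List (V N)) n ρ Rs → map region (A ++ B) ≡ replicate n ρ ++ Rs → length A ≡ n → map region B ≡ Rs
regions-drop []      B zero    ρ Rs eq refl = eq
regions-drop (v ∷ A) B (suc n) ρ Rs eq refl = regions-drop A B n ρ Rs (proj₂ (∷-injective eq)) refl

regions-length : ∀ {N} (vs : List (V N)) n ρ Rs → map region vs ≡ replicate n ρ ++ Rs → n + length Rs ≡ length vs
regions-length []       zero    ρ []       eq = refl
regions-length (v ∷ vs) zero    ρ Rs       eq = trans (cong length (sym eq)) (length-map region (v ∷ vs))
regions-length (v ∷ vs) (suc n) ρ Rs       eq = cong suc (regions-length vs n ρ Rs (proj₂ (∷-injective eq)))

regions-length-≥ : ∀ {N} (v : V N) ws n ρ Rs → map region (v ∷ ws) ≡ replicate n ρ ++ Rs → 1 ≤ length Rs → n ≤ length ws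
regions-length-≥ v ws n ρ Rs eq nonempty =
  ≤-pred (≤-trans (≤-trans (≤-reflexive (+-comm 1 n)) (+-monoʳ-≤ n nonempty)) (≤-reflexive (regions-length (v ∷ ws) n ρ Rs eq)))

replicate-head : ∀ {A : Set} n (x : A) xs → 1 ≤ n → replicate n x ++ xs ≡ x ∷ (replicate (pred n) x ++ xs)
replicate-head (suc n) x xs _ = refl

-- Throughout,  c = suc c₁  is the length of every connecting path and subdivided edge,
-- so each of them has c₁ interior vertices.
module PathEnumeration (c₁ h : ℕ) {N : ℕ} (adjA : Fin N → Fin N → Set) (f : Side → List ℕ → Fin N)
                       (cubic : IsCubic adjA) (bij : IsLeafBijection h f) (1≤c₁ : 1 ≤ c₁) where

  c : ℕ
  c = suc c₁

  Vertex : Set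
  Vertex = V N

  Valid : Vertex → Set
  Valid = ValidV h c adjA

  _~_ : Vertex → Vertex → Set
  _~_ = Adj c f

  tree-nbrs : ∀ {s a v} → tree s a ~ v →
    (∃[ x ] v ≡ tree s (a ++ x ∷ [])) ⊎ (∃[ p ] ∃[ x ] (a ≡ p ++ x ∷ [] × v ≡ tree s p)) ⊎ (v ≡ star) ⊎ (v ≡ conn s a 1)
  tree-nbrs (inj₁ (child s a x))  = inj₁ (x , refl)
  tree-nbrs (inj₁ (leafConn s a)) = inj₂ (inj₂ (inj₂ refl))
  tree-nbrs (inj₂ (root s))       = inj₂ (inj₂ (inj₁ refl))
  tree-nbrs (inj₂ (child s p x))  = inj₂ (inj₁ (p , x , refl , refl))

  conn-nbrs : ∀ {s a i v} → conn s a i ~ v →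
    (v ≡ conn s a (suc i)) ⊎ (∃[ i′ ] (i ≡ suc i′ × v ≡ conn s a i′)) ⊎ (i ≡ 1 × v ≡ tree s a) ⊎ (i ≡ c₁ × v ≡ avert (f s a))
  conn-nbrs (inj₁ (connConn s a i)) = inj₁ refl
  conn-nbrs (inj₁ (connA s a))      = inj₂ (inj₂ (inj₂ (refl , refl)))
  conn-nbrs (inj₂ (leafConn s a))   = inj₂ (inj₂ (inj₁ (refl , refl)))
  conn-nbrs (inj₂ (connConn s a i)) = inj₂ (inj₁ (i , refl , refl))

  sub-nbrs : ∀ {p q i v} → sub p q i ~ v →
    (v ≡ sub p q (suc i)) ⊎ (∃[ i′ ] (i ≡ suc i′ × v ≡ sub p q i′)) ⊎ (i ≡ 1 × v ≡ avert p) ⊎ (i ≡ c₁ × v ≡ avert q)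
  sub-nbrs (inj₁ (subSub p q i)) = inj₁ refl
  sub-nbrs (inj₁ (subA p q))     = inj₂ (inj₂ (inj₂ (refl , refl)))
  sub-nbrs (inj₂ (aSub p q))     = inj₂ (inj₂ (inj₁ (refl , refl)))
  sub-nbrs (inj₂ (subSub p q i)) = inj₂ (inj₁ (i , refl , refl))

  avert-nbrs : ∀ {x v} → avert x ~ v →
    (∃[ y ] v ≡ sub x y 1) ⊎ (∃[ y ] v ≡ sub y x c₁) ⊎ (∃[ s ] ∃[ a ] (x ≡ f s a × v ≡ conn s a c₁))
  avert-nbrs (inj₁ (aSub x y)) = inj₁ (y , refl)
  avert-nbrs (inj₂ (connA s a)) = inj₂ (inj₂ (s , a , refl , refl))
  avert-nbrs (inj₂ (subA y x))  = inj₂ (inj₁ (y , refl))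

  -- The vertices  0, 1, …, c  of a path of length c from `start` to `end` whose interior vertices are
  -- `interior 1, …, interior c₁`.
  choose : {P : Set} → Dec P → Vertex → Vertex → Vertex
  choose (yes _) x y = x
  choose (no _)  x y = y

  pathVertex : Vertex → (ℕ → Vertex) → Vertex → ℕ → Vertex
  pathVertex start interior end zero    = start
  pathVertex start interior end (suc j) = choose (suc j ≤? c₁) (interior (suc j)) end

  pathVertex-interior : ∀ start interior end j → 1 ≤ j → j ≤ c₁ → pathVertex start interior end j ≡ interior j
  pathVertex-interior start interior end (suc j) _ j≤c₁ with suc j ≤? c₁
  ... | yes _    = refl
  ... | no  j≰c₁ = contradiction j≤c₁ j≰c₁

  pathVertex-end : ∀ start interior end → pathVertex start interior end c ≡ end
  pathVertex-end start interior end with c ≤? c₁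
  ... | yes c≤c₁ = contradiction c≤c₁ (<⇒≱ ≤-refl)
  ... | no  _    = refl

  Forced : (ℕ → Vertex) → Set
  Forced g = ∀ j → 1 ≤ j → j ≤ c₁ → ∀ v → g j ~ v → Valid v → v ≡ g (pred j) ⊎ v ≡ g (suc j)

  InteriorNbrs : (ℕ → Vertex) → Vertex → Vertex → Set
  InteriorNbrs K lo hi = ∀ i v → K i ~ v → Valid v →
    (v ≡ K (suc i) × suc i ≤ c₁) ⊎ (∃[ i′ ] (i ≡ suc i′ × v ≡ K i′ × 1 ≤ i′)) ⊎ (i ≡ 1 × v ≡ lo) ⊎ (i ≡ c₁ × v ≡ hi)

  conn-interiorNbrs : ∀ s a → InteriorNbrs (conn s a) (tree s a) (avert (f s a))
  conn-interiorNbrs s a i v adj valid with conn-nbrs adj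
  ... | inj₁ refl                      = inj₁ (refl , proj₂ (proj₂ valid))
  ... | inj₂ (inj₁ (i′ , refl , refl)) = inj₂ (inj₁ (i′ , refl , refl , proj₁ (proj₂ valid)))
  ... | inj₂ (inj₂ end)                = inj₂ (inj₂ end)

  sub-interiorNbrs : ∀ p q → InteriorNbrs (sub p q) (avert p) (avert q)
  sub-interiorNbrs p q i v adj valid with sub-nbrs adj
  ... | inj₁ refl                      = inj₁ (refl , proj₂ (proj₂ (proj₂ valid)))
  ... | inj₂ (inj₁ (i′ , refl , refl)) = inj₂ (inj₁ (i′ , refl , refl , proj₁ (proj₂ (proj₂ valid))))
  ... | inj₂ (inj₂ end)                = inj₂ (inj₂ end)

  forced-forward : ∀ K lo hi → InteriorNbrs K lo hi → Forced (pathVertex lo K hi)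
  forced-forward K lo hi nbrs j 1≤j j≤c₁ v adj valid
    with nbrs j v (subst (_~ v) (pathVertex-interior lo K hi j 1≤j j≤c₁) adj) valid
  ... | inj₁ (refl , sj≤c₁)              = inj₂ (sym (pathVertex-interior lo K hi (suc j) (s≤s z≤n) sj≤c₁))
  ... | inj₂ (inj₁ (i′ , refl , refl , 1≤i′)) = inj₁ (sym (pathVertex-interior lo K hi i′ 1≤i′ (≤-trans (n≤1+n i′) j≤c₁)))
  ... | inj₂ (inj₂ (inj₁ (refl , refl))) = inj₁ refl
  ... | inj₂ (inj₂ (inj₂ (refl , refl))) = inj₂ (sym (pathVertex-end lo K hi))

  reversed : (ℕ → Vertex) → ℕ → Vertex
  reversed K j = K (c ∸ j)

  forced-backward : ∀ K lo hi → InteriorNbrs K lo hi → Forced (pathVertex hi (reversed K) lo)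
  forced-backward K lo hi nbrs (suc j) 1≤sj sj≤c₁ v adj valid
    with nbrs (c₁ ∸ j) v (subst (_~ v) (pathVertex-interior hi (reversed K) lo (suc j) 1≤sj sj≤c₁) adj) valid
  ... | inj₁ (v≡ , le) = inj₁ (trans v≡ (trans (cong K (sym (+-∸-assoc 1 j≤c₁)))
                                           (sym (pathVertex-interior hi (reversed K) lo j (positive j le) j≤c₁))))
    where
    j≤c₁ : j ≤ c₁
    j≤c₁ = ≤-trans (n≤1+n j) sj≤c₁
    positive : ∀ j → suc (c₁ ∸ j) ≤ c₁ → 1 ≤ j
    positive zero    le = contradiction le (<⇒≱ ≤-refl)
    positive (suc _) _  = s≤s z≤n
  ... | inj₂ (inj₁ (i′ , i≡ , v≡ , 1≤i′)) =
    inj₂ (trans v≡ (trans (cong K i′≡) (sym (pathVertex-interior hi (reversed K) lo (suc (suc j)) (s≤s z≤n) ssj≤c₁))))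
    where
    sum≡ : suc i′ + j ≡ c₁
    sum≡ = trans (cong (_+ j) (sym i≡)) (m∸n+n≡m (≤-trans (n≤1+n j) sj≤c₁))
    ssj≤c₁ : suc (suc j) ≤ c₁
    ssj≤c₁ = ≤-trans (+-monoˡ-≤ j (s≤s 1≤i′)) (≤-reflexive sum≡)
    i′≡ : i′ ≡ c ∸ suc (suc j)
    i′≡ = trans (cong pred (sym i≡)) (pred[m∸n]≡m∸[1+n] c₁ j)
  ... | inj₂ (inj₂ (inj₁ (i≡ , v≡))) =
    inj₂ (trans v≡ (sym (trans (cong (pathVertex hi (reversed K) lo) ssj≡c) (pathVertex-end hi (reversed K) lo))))
    where
    ssj≡c : suc (suc j) ≡ c
    ssj≡c = cong suc (trans (cong (_+ j) (sym i≡)) (m∸n+n≡m (≤-trans (n≤1+n j) sj≤c₁)))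
  ... | inj₂ (inj₂ (inj₂ (i≡ , v≡))) with j
  ...   | zero   = inj₁ v≡
  ...   | suc j′ = contradiction i≡ (<⇒≢ (shorter c₁ j′ 1≤c₁))
    where shorter : ∀ m n → 1 ≤ m → m ∸ suc n < m
          shorter (suc m) n _ = s≤s (m∸n≤m m n)

  countFrom : ℕ → ℕ → List ℕ
  countFrom j zero    = []
  countFrom j (suc k) = j ∷ countFrom (suc j) k

  countFrom-snoc : ∀ j k → countFrom j (suc k) ≡ countFrom j k ++ (j + k) ∷ []
  countFrom-snoc j zero    = cong [_] (sym (+-identityʳ j))
  countFrom-snoc j (suc k) = cong (j ∷_) (trans (countFrom-snoc (suc j) k) (cong (λ z → countFrom (suc j) k ++ [ z ]) (sym (+-suc j k))))

  length-countFrom : ∀ j k → length (countFrom j k) ≡ k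
  length-countFrom j zero    = refl
  length-countFrom j (suc k) = cong suc (length-countFrom (suc j) k)

  interior : (ℕ → Vertex) → List Vertex
  interior g = map g (countFrom 1 c₁)

  length-interior : ∀ g → length (interior g) ≡ c₁
  length-interior g = trans (length-map g (countFrom 1 c₁)) (length-countFrom 1 c₁)

  -- A simple walk that has entered a forced path at its vertices j-1, j must continue along it:
  -- its next k vertices are  g (j+1), …, g (j+k)  as long as  j + k ≤ c.
  follow : (g : ℕ → Vertex) → Forced g → ∀ k j prev cur ws → prev ≡ g (pred j) → cur ≡ g j → j + k ≡ c → 1 ≤ j →
           IsWalk c f (prev ∷ cur ∷ ws) → Unique (prev ∷ cur ∷ ws) → All Valid ws → k ≤ length ws →
           ∃[ rest ] ws ≡ map g (countFrom (suc j) k) ++ rest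
  follow g forced zero    j prev cur ws        _ _ _ _ _ _ _ _ = ws , refl
  follow g forced (suc k) j prev cur (v ∷ ws) prev≡ cur≡ j+k≡ 1≤j (_ , cur~v , walk) ((_ ∷ v≢prev ∷ _) ∷ uniq) (valid ∷ valids) (s≤s k≤)
    with forced j 1≤j j≤c₁ v (subst (_~ v) cur≡ cur~v) valid
    where j≤c₁ = ≤-trans (m≤m+n j k) (≤-reflexive (suc-injective (trans (sym (+-suc j k)) j+k≡)))
  ... | inj₁ v≡prev = contradiction (trans prev≡ (sym v≡prev)) v≢prev
  ... | inj₂ v≡next with follow g forced k (suc j) cur v ws cur≡ v≡next (trans (sym (+-suc j k)) j+k≡) (s≤s z≤n)
                                (cur~v , walk) uniq valids k≤
  ...   | rest , ws≡ = rest , cong₂ _∷_ v≡next ws≡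

  traverse : (g : ℕ → Vertex) → Forced g → ∀ prev cur ws → prev ≡ g 0 → cur ≡ g 1 →
             IsWalk c f (prev ∷ cur ∷ ws) → Unique (prev ∷ cur ∷ ws) → All Valid ws → c₁ ≤ length ws →
             ∃[ rest ] cur ∷ ws ≡ interior g ++ g c ∷ rest
  traverse g forced prev cur ws prev≡ cur≡ walk uniq valids len
    with follow g forced c₁ 1 prev cur ws prev≡ cur≡ refl (s≤s z≤n) walk uniq valids len
  ... | rest , ws≡ = rest , (begin
    cur ∷ ws                                 ≡⟨ cong₂ _∷_ cur≡ ws≡ ⟩
    map g (countFrom 1 (suc c₁)) ++ rest     ≡⟨ cong (λ z → map g z ++ rest) (countFrom-snoc 1 c₁) ⟩
    map g (countFrom 1 c₁ ++ [ c ]) ++ rest  ≡⟨ cong (_++ rest) (map-++ g (countFrom 1 c₁) [ c ]) ⟩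
    (interior g ++ [ g c ]) ++ rest          ≡⟨ ++-assoc (interior g) [ g c ] rest ⟩
    interior g ++ g c ∷ rest                 ∎)
    where open ≡-Reasoning

  -- Suffixes of paths in 𝒫: simple walks through valid vertices ending at a leaf.
  IsLeafVertex : Vertex → Set
  IsLeafVertex (tree s a) = length a ≡ h
  IsLeafVertex _          = ⊥

  EndsAtLeaf : List Vertex → Set
  EndsAtLeaf []           = ⊥
  EndsAtLeaf (x ∷ [])     = IsLeafVertex x
  EndsAtLeaf (x ∷ y ∷ ys) = EndsAtLeaf (y ∷ ys)

  PathTail : List Vertex → Set
  PathTail vs = IsWalk c f vs × All Valid vs × Unique vs × EndsAtLeaf vs

  PathTail-tail : ∀ {x y ys} → PathTail (x ∷ y ∷ ys) → PathTail (y ∷ ys)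
  PathTail-tail ((_ , walk) , (_ ∷ valid) , (_ ∷ uniq) , end) = walk , valid , uniq , end

  PathTail-suffix : ∀ A b B → PathTail (A ++ b ∷ B) → PathTail (b ∷ B)
  PathTail-suffix []           b B tail = tail
  PathTail-suffix (a ∷ [])     b B tail = PathTail-tail tail
  PathTail-suffix (a ∷ a′ ∷ A) b B tail = PathTail-suffix (a′ ∷ A) b B (PathTail-tail tail)

  EndsAtLeaf-snoc : ∀ vs s a → length a ≡ h → EndsAtLeaf (vs ++ tree s a ∷ [])
  EndsAtLeaf-snoc []           s a leaf = leaf
  EndsAtLeaf-snoc (v ∷ [])     s a leaf = leaf
  EndsAtLeaf-snoc (v ∷ w ∷ vs) s a leaf = EndsAtLeaf-snoc (w ∷ vs) s a leaf

  ∉-later : ∀ {x : Vertex} {ws : List Vertex} (A B : List Vertex) → Unique (x ∷ ws) → ws ≡ A ++ B → x ∉ B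
  ∉-later A B (x∉ ∷ _) refl x∈B = All.lookup x∉ (∈-++⁺ʳ A x∈B) refl

  nbrs : Fin N → List (Fin N)
  nbrs x = proj₁ (proj₂ (proj₂ cubic) x)

  length-nbrs : ∀ x → length (nbrs x) ≡ 3
  length-nbrs x = proj₁ (proj₂ (proj₂ (proj₂ cubic) x))

  adj⇒∈nbrs : ∀ {x y} → adjA x y → y ∈ nbrs x
  adj⇒∈nbrs {x} {y} = proj₁ (proj₂ (proj₂ (proj₂ (proj₂ (proj₂ cubic) x))) y)

  ∈nbrs⇒adj : ∀ {x y} → y ∈ nbrs x → adjA x y
  ∈nbrs⇒adj {x} {y} = proj₂ (proj₂ (proj₂ (proj₂ (proj₂ (proj₂ cubic) x))) y)

  adj-sym : ∀ {x y} → adjA x y → adjA y x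
  adj-sym {x} {y} = proj₁ cubic x y

  sideOf : Fin N → Side
  sideOf z = proj₁ (proj₂ bij z)

  leafOf : Fin N → List ℕ
  leafOf z = proj₁ (proj₂ (proj₂ bij z))

  leafOf-leaf : ∀ z → IsLeaf h (leafOf z)
  leafOf-leaf z = proj₁ (proj₂ (proj₂ (proj₂ bij z)))

  f-leafOf : ∀ z → f (sideOf z) (leafOf z) ≡ z
  f-leafOf z = proj₂ (proj₂ (proj₂ (proj₂ bij z)))

  f-injective : ∀ {s s′ a a′} → IsLeaf h a → IsLeaf h a′ → f s a ≡ f s′ a′ → s ≡ s′ × a ≡ a′
  f-injective {s} {s′} {a} {a′} = proj₁ bij s s′ a a′

  -- The three kinds of forced paths: up from a leaf to A, down from A to a leaf, and along a
  -- subdivided edge of A (stored as  sub p q  with toℕ p < toℕ q, so one direction is reversed).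
  upPath : Side → List ℕ → ℕ → Vertex
  upPath s a = pathVertex (tree s a) (conn s a) (avert (f s a))

  downPath : Fin N → ℕ → Vertex
  downPath z = pathVertex (avert (f (sideOf z) (leafOf z))) (reversed (conn (sideOf z) (leafOf z))) (tree (sideOf z) (leafOf z))

  edgePath′ : (x y : Fin N) → Dec (toℕ x < toℕ y) → ℕ → Vertex
  edgePath′ x y (yes _) = pathVertex (avert x) (sub x y) (avert y)
  edgePath′ x y (no _)  = pathVertex (avert x) (reversed (sub y x)) (avert y)

  edgePath : Fin N → Fin N → ℕ → Vertex
  edgePath x y = edgePath′ x y (toℕ x <? toℕ y)

  upPath-forced : ∀ s a → Forced (upPath s a)
  upPath-forced s a = forced-forward (conn s a) (tree s a) (avert (f s a)) (conn-interiorNbrs s a)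

  downPath-forced : ∀ z → Forced (downPath z)
  downPath-forced z = forced-backward (conn (sideOf z) (leafOf z)) (tree (sideOf z) (leafOf z))
                                      (avert (f (sideOf z) (leafOf z))) (conn-interiorNbrs (sideOf z) (leafOf z))

  edgePath-forced : ∀ x y → Forced (edgePath x y)
  edgePath-forced x y with toℕ x <? toℕ y
  ... | yes _ = forced-forward (sub x y) (avert x) (avert y) (sub-interiorNbrs x y)
  ... | no  _ = forced-backward (sub y x) (avert y) (avert x) (sub-interiorNbrs y x)

  edgePath-start : ∀ x y → edgePath x y 0 ≡ avert x
  edgePath-start x y with toℕ x <? toℕ y
  ... | yes _ = refl
  ... | no  _ = refl

  edgePath-end : ∀ x y → edgePath x y c ≡ avert y
  edgePath-end x y with toℕ x <? toℕ y
  ... | yes _ = pathVertex-end (avert x) (sub x y) (avert y)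
  ... | no  _ = pathVertex-end (avert x) (reversed (sub y x)) (avert y)

  parent : List ℕ → List ℕ
  parent []           = []
  parent (x ∷ [])     = []
  parent (x ∷ y ∷ xs) = x ∷ parent (y ∷ xs)

  parent-snoc : ∀ p x → parent (p ++ [ x ]) ≡ p
  parent-snoc []           x = refl
  parent-snoc (y ∷ [])     x = refl
  parent-snoc (y ∷ y′ ∷ p) x = cong (y ∷_) (parent-snoc (y′ ∷ p) x)

  length-parent : ∀ y a → length (parent (y ∷ a)) ≡ length a
  length-parent y []       = refl
  length-parent y (y′ ∷ a) = cong suc (length-parent y′ a)

  length-snoc : ∀ (a : List ℕ) x → length (a ++ [ x ]) ≡ suc (length a)
  length-snoc a x = trans (length-++ a) (+-comm (length a) 1)

  -- What may follow a tree segment that ends at the leaf a of T_s.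
  Continuation : Set
  Continuation = Side → List ℕ → List (List Vertex)

  treeSegments : Side → List ℕ → ℕ → ℕ → Continuation → List (List Vertex)
  treeSegments s a       zero    zero    k = map (tree s a ∷_) (k s a)
  treeSegments s a       zero    (suc d) k =
    concatMap (λ i → map (tree s a ∷_) (treeSegments s (a ++ [ i ]) zero d k)) (downFrom (branching h (length a)))
  treeSegments s []      (suc u) d       k = []
  treeSegments s (x ∷ a) (suc u) d       k = map (tree s (x ∷ a) ∷_) (treeSegments s (parent (x ∷ a)) u d k)

  treeSegments-snoc : ∀ s p x u d k → treeSegments s (p ++ [ x ]) (suc u) d k ≡ map (tree s (p ++ [ x ]) ∷_) (treeSegments s p u d k)
  treeSegments-snoc s []      x u d k = refl
  treeSegments-snoc s (y ∷ p) x u d k = cong (λ q → map (tree s (y ∷ p ++ [ x ]) ∷_) (treeSegments s q u d k)) (parent-snoc (y ∷ p) x)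

  -- The non-backtracking continuations of an expander walk at x, coming from the vertex p (if any).
  choices : Maybe (Fin N) → Fin N → List (Fin N)
  choices nothing  x = nbrs x
  choices (just p) x = filter (λ y → ¬? (y ≟ᶠ p)) (nbrs x)

  expanderWalks : Maybe (Fin N) → Fin N → ℕ → (Fin N → List (List Vertex)) → List (List Vertex)
  expanderWalks p x zero    K = map (avert x ∷_) (K x)
  expanderWalks p x (suc e) K =
    concatMap (λ y → map (λ w → avert x ∷ (interior (edgePath x y) ++ w)) (expanderWalks (just x) y e K)) (choices p x)

  paths : Side → List ℕ → List ℕ → List (List Vertex)
  climb : ℕ → List ℕ → Continuation
  descend : List ℕ → Fin N → List (List Vertex)

  paths s a []           = []
  paths s a (t ∷ [])     = treeSegments s a t t (λ _ _ → [ [] ])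
  paths s a (t ∷ e ∷ ts) = treeSegments s a t t (climb e ts)

  climb e ts s a = map (interior (upPath s a) ++_) (expanderWalks nothing (f s a) e (descend ts))

  descend ts z = map (interior (downPath z) ++_) (paths (sideOf z) (leafOf z) ts)

  child<branching : ∀ i a x → ValidAddrFrom h i (a ++ [ x ]) → x < branching h (i + length a)
  child<branching i []      x (_ , x< , _) rewrite +-identityʳ i = x<
  child<branching i (y ∷ a) x (_ , _ , valid) rewrite +-suc i (length a) = child<branching (suc i) a x valid

  Accepts : Continuation → List Region → Set
  Accepts k Rs = ∀ s a M → PathTail (tree s a ∷ M) → map region M ≡ Rs → length a ≡ h × M ∈ k s a

  -- A path tail that has just stepped down from p to its child a and then keeps n more tree vertices
  -- descends n further levels (the parent is never revisited), so it is a listed descent.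
  descent-complete : ∀ n s a p x M Rs k → a ≡ p ++ [ x ] → PathTail (tree s a ∷ M) → tree s p ∉ M →
                     map region M ≡ replicate n Tr ++ Rs → Accepts k Rs →
                     length a + n ≡ h × (tree s a ∷ M) ∈ treeSegments s a zero n k
  descent-complete zero s a p x M Rs k _ tail _ regs accepts with accepts s a M tail regs
  ... | leaf , M∈ = trans (+-identityʳ _) leaf , ∈-map⁺ (tree s a ∷_) M∈
  descent-complete (suc n) s a p x (v ∷ M) Rs k a≡ tail@((a~v , _) , (_ ∷ valid ∷ _) , (fresh ∷ _) , _) p∉ regs accepts
    with ∷-injective regs | tree-nbrs a~v
  ... | _ , regs′ | inj₁ (y , refl)
    with descent-complete n s (a ++ [ y ]) a y M Rs k refl (PathTail-tail tail) (λ a∈M → All.lookup fresh (there a∈M) refl) regs′ accepts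
  ...   | leaf , rest∈ = trans (+-suc (length a) n) (trans (cong (_+ n) (sym (length-snoc a y))) leaf) ,
                        ∈-concatMap (∈-map⁺ (tree s a ∷_) rest∈) (∈-downFrom⁺ (child<branching 0 a y valid))
  descent-complete (suc n) s a p x (v ∷ M) Rs k a≡ _ p∉ _ _ | _ | inj₂ (inj₁ (q , y , a≡′ , refl)) =
    contradiction (here (cong (tree s) (sym (proj₁ (∷ʳ-injective q p (trans (sym a≡′) a≡)))))) p∉
  descent-complete (suc n) s a p x (v ∷ M) Rs k _ _ _ _ _ | () , _ | inj₂ (inj₂ (inj₁ refl))
  descent-complete (suc n) s a p x (v ∷ M) Rs k _ _ _ _ _ | () , _ | inj₂ (inj₂ (inj₂ refl))

  segment-complete : ∀ n s a M Rs k → PathTail (tree s a ∷ M) → map region M ≡ replicate n Tr ++ Rs → Accepts k Rs →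
                     ∃[ u ] ∃[ d ] (u + d ≡ n × u ≤ length a × length a ∸ u + d ≡ h × (tree s a ∷ M) ∈ treeSegments s a u d k)
  segment-complete zero s a M Rs k tail regs accepts with accepts s a M tail regs
  ... | leaf , M∈ = 0 , 0 , refl , z≤n , trans (+-identityʳ _) leaf , ∈-map⁺ (tree s a ∷_) M∈
  segment-complete (suc n) s a (v ∷ M) Rs k tail@((a~v , _) , (_ ∷ valid ∷ _) , (fresh ∷ _) , _) regs accepts
    with ∷-injective regs | tree-nbrs a~v
  ... | _ , regs′ | inj₁ (y , refl)
    with descent-complete n s (a ++ [ y ]) a y M Rs k refl (PathTail-tail tail) (λ a∈M → All.lookup fresh (there a∈M) refl) regs′ accepts
  ...   | leaf , rest∈ = 0 , suc n , refl , z≤n , trans (+-suc (length a) n) (trans (cong (_+ n) (sym (length-snoc a y))) leaf) ,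
                        ∈-concatMap (∈-map⁺ (tree s a ∷_) rest∈) (∈-downFrom⁺ (child<branching 0 a y valid))
  segment-complete (suc n) s a (v ∷ M) Rs k tail regs accepts | _ , regs′ | inj₂ (inj₁ (q , y , refl , refl))
    with segment-complete n s q M Rs k (PathTail-tail tail) regs′ accepts
  ... | u , d , u+d≡ , u≤ , ends , rest∈ =
    suc u , d , cong suc u+d≡ , ≤-trans (s≤s u≤) (≤-reflexive (sym (length-snoc q y))) ,
    trans (cong (λ z → z ∸ suc u + d) (length-snoc q y)) ends ,
    subst ((tree s (q ++ [ y ]) ∷ tree s q ∷ M) ∈_) (sym (treeSegments-snoc s q y u d k)) (∈-map⁺ (tree s (q ++ [ y ]) ∷_) rest∈)
  segment-complete (suc n) s a (v ∷ M) Rs k _ _ _ | () , _ | inj₂ (inj₂ (inj₁ refl))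
  segment-complete (suc n) s a (v ∷ M) Rs k _ _ _ | () , _ | inj₂ (inj₂ (inj₂ refl))

  tree-exit : ∀ {s a v} → tree s a ~ v → region v ≡ Cn → v ≡ conn s a 1
  tree-exit adj regionCn with tree-nbrs adj
  tree-exit adj () | inj₁ (_ , refl)
  tree-exit adj () | inj₂ (inj₁ (_ , _ , _ , refl))
  tree-exit adj () | inj₂ (inj₂ (inj₁ refl))
  tree-exit adj _  | inj₂ (inj₂ (inj₂ v≡)) = v≡

  avert-exit-edge : ∀ {x v} → avert x ~ v → Valid v → region v ≡ Ex → ∃[ y ] (y ∈ nbrs x × v ≡ edgePath x y 1)
  avert-exit-edge {x} adj valid regionEx with avert-nbrs adj
  ... | inj₁ (y , refl) = y , adj⇒∈nbrs (proj₁ (proj₂ valid)) , forward (toℕ x <? toℕ y)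
    where
    forward : ∀ d → sub x y 1 ≡ edgePath′ x y d 1
    forward (yes _)  = sym (pathVertex-interior (avert x) (sub x y) (avert y) 1 (s≤s z≤n) 1≤c₁)
    forward (no x≮y) = contradiction (proj₁ valid) x≮y
  ... | inj₂ (inj₁ (y , refl)) = y , adj⇒∈nbrs (adj-sym (proj₁ (proj₂ valid))) , backward (toℕ x <? toℕ y)
    where
    backward : ∀ d → sub y x c₁ ≡ edgePath′ x y d 1
    backward (yes x<y) = contradiction (proj₁ valid) (<⇒≯ x<y)
    backward (no _)    = sym (pathVertex-interior (avert x) (reversed (sub y x)) (avert y) 1 (s≤s z≤n) 1≤c₁)
  avert-exit-edge adj valid () | inj₂ (inj₂ (_ , _ , _ , refl))

  avert-exit-down : ∀ {z v} → avert z ~ v → Valid v → region v ≡ Cn → v ≡ downPath z 1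
  avert-exit-down adj valid regionCn with avert-nbrs adj
  avert-exit-down adj valid () | inj₁ (_ , refl)
  avert-exit-down adj valid () | inj₂ (inj₁ (_ , refl))
  avert-exit-down adj valid _  | inj₂ (inj₂ (s , a , refl , refl))
    with f-injective (proj₁ valid) (leafOf-leaf (f s a)) (sym (f-leafOf (f s a)))
  ... | s≡ , a≡ = trans (cong₂ (λ s a → conn s a c₁) s≡ a≡)
                        (sym (pathVertex-interior (avert (f s′ a′)) (reversed (conn s′ a′)) (tree s′ a′) 1 (s≤s z≤n) 1≤c₁))
    where s′ : Side
          s′ = sideOf (f s a)
          a′ : List ℕ
          a′ = leafOf (f s a)

  Fresh : Maybe (Fin N) → List Vertex → Set
  Fresh nothing  _  = ⊤
  Fresh (just p) vs = avert p ∉ vs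

  AcceptsAt : (Fin N → List (List Vertex)) → List Region → Set
  AcceptsAt K Rs = ∀ z M → PathTail (avert z ∷ M) → map region M ≡ Rs → M ∈ K z

  c*suc : ∀ e → c * suc e ≡ c₁ + suc (c * e)
  c*suc e = regroup c₁ e
    where regroup : ∀ c₁ e → suc c₁ * suc e ≡ c₁ + suc (suc c₁ * e)
          regroup = solve-∀

  edge-step : ∀ e x v ws Rs → PathTail (avert x ∷ v ∷ ws) → map region (v ∷ ws) ≡ replicate (c * suc e) Ex ++ Rs →
              ∃[ y ] ∃[ rest ] (y ∈ nbrs x × v ∷ ws ≡ interior (edgePath x y) ++ avert y ∷ rest ×
                               map region rest ≡ replicate (c * e) Ex ++ Rs)
  edge-step e x v ws Rs tail@((x~v , walk) , (_ ∷ valid ∷ valids) , uniq , _) regs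
    with avert-exit-edge x~v valid (proj₁ (∷-injective regs))
  ... | y , y∈ , v≡ with traverse (edgePath x y) (edgePath-forced x y) (avert x) v ws (sym (edgePath-start x y)) v≡
                                  (x~v , walk) uniq valids long
    where
    long : c₁ ≤ length ws
    long = ≤-trans (m≤m+n c₁ (c * e + length Rs))
             (≤-reflexive (suc-injective (trans (sym (+-suc c₁ (c * e + length Rs)))
               (trans (sym (+-assoc c₁ (suc (c * e)) (length Rs)))
                 (trans (cong (_+ length Rs) (sym (c*suc e))) (regions-length (v ∷ ws) (c * suc e) Ex Rs regs))))))
  ... | rest , ws≡ = y , rest , y∈ , vws≡ , proj₂ (∷-injective (regions-drop (interior (edgePath x y)) (avert y ∷ rest) c₁ Ex _ regs′ (length-interior (edgePath x y))))
    where
    vws≡ : v ∷ ws ≡ interior (edgePath x y) ++ avert y ∷ rest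
    vws≡ = trans ws≡ (cong (λ z → interior (edgePath x y) ++ z ∷ rest) (edgePath-end x y))
    regs′ : map region (interior (edgePath x y) ++ avert y ∷ rest) ≡ replicate c₁ Ex ++ (Ex ∷ replicate (c * e) Ex ++ Rs)
    regs′ = begin
      map region (interior (edgePath x y) ++ avert y ∷ rest) ≡⟨ cong (map region) vws≡ ⟨
      map region (v ∷ ws)                                    ≡⟨ regs ⟩
      replicate (c * suc e) Ex ++ Rs                         ≡⟨ cong (λ n → replicate n Ex ++ Rs) (c*suc e) ⟩
      replicate (c₁ + suc (c * e)) Ex ++ Rs                  ≡⟨ cong (_++ Rs) (replicate-+ c₁ (suc (c * e)) Ex) ⟩
      (replicate c₁ Ex ++ replicate (suc (c * e)) Ex) ++ Rs  ≡⟨ ++-assoc (replicate c₁ Ex) (replicate (suc (c * e)) Ex) Rs ⟩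
      replicate c₁ Ex ++ (Ex ∷ replicate (c * e) Ex ++ Rs)   ∎
      where open ≡-Reasoning

  expanderWalks-complete : ∀ e p x M Rs K → PathTail (avert x ∷ M) → map region M ≡ replicate (c * e) Ex ++ Rs →
                           Fresh p (avert x ∷ M) → AcceptsAt K Rs → (avert x ∷ M) ∈ expanderWalks p x e K
  expanderWalks-complete zero p x M Rs K tail regs _ accepts =
    ∈-map⁺ (avert x ∷_) (accepts x M tail (subst (λ n → map region M ≡ replicate n Ex ++ Rs) (*-zeroʳ c) regs))
  expanderWalks-complete (suc e) p x (v ∷ ws) Rs K tail@(_ , _ , (x∉ ∷ uniq) , _) regs fresh accepts
    with edge-step e x v ws Rs tail regs
  ... | y , rest , y∈ , vws≡ , regs′ =
    subst (λ W → (avert x ∷ W) ∈ expanderWalks p x (suc e) K) (sym vws≡)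
          (∈-concatMap (∈-map⁺ (λ w → avert x ∷ (interior (edgePath x y) ++ w)) rest∈) (y∈choices p fresh))
    where
    tail′ : PathTail (avert y ∷ rest)
    tail′ = PathTail-suffix (avert x ∷ interior (edgePath x y)) (avert y) rest (subst (λ W → PathTail (avert x ∷ W)) vws≡ tail)
    rest∈ : (avert y ∷ rest) ∈ expanderWalks (just x) y e K
    rest∈ = expanderWalks-complete e (just x) y rest Rs K tail′ regs′
              (∉-later (interior (edgePath x y)) (avert y ∷ rest) (x∉ ∷ uniq) vws≡) accepts
    y-visited : avert y ∈ (avert x ∷ v ∷ ws)
    y-visited = there (subst (avert y ∈_) (sym vws≡) (∈-++⁺ʳ (interior (edgePath x y)) (here refl)))
    y∈choices : ∀ p → Fresh p (avert x ∷ v ∷ ws) → y ∈ choices p x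
    y∈choices nothing  _     = y∈
    y∈choices (just q) q∉ = ∈-filter⁺ (λ y → ¬? (y ≟ᶠ q)) y∈ (λ y≡q → q∉ (subst (λ z → avert z ∈ (avert x ∷ v ∷ ws)) y≡q y-visited))

  OddLength : List ℕ → Set
  OddLength []          = ⊥
  OddLength (x ∷ [])    = ⊤
  OddLength (x ∷ y ∷ r) = OddLength r

  odd-length : ∀ (t : List ℕ) n → length t ≡ 2 * n + 1 → OddLength t
  odd-length []          n len = contradiction len (λ eq → 0≢1+n (trans eq (+-comm (2 * n) 1)))
  odd-length (x ∷ [])    n len = tt
  odd-length (x ∷ y ∷ t) zero    ()
  odd-length (x ∷ y ∷ t) (suc n) len = odd-length t n (odd-length-tail {r = t} n len)

  expected-nonempty : ∀ ts → OddLength ts → 1 ≤ length (expected c ts)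
  expected-nonempty (t ∷ [])     _ rewrite +-comm (2 * t) 1 = s≤s z≤n
  expected-nonempty (t ∷ e ∷ ts) _ rewrite +-comm (2 * t) 1 = s≤s z≤n

  replicate-odd : ∀ {A : Set} t (x : A) xs → replicate (2 * t + 1) x ++ xs ≡ x ∷ (replicate (2 * t) x ++ xs)
  replicate-odd t x xs = cong (λ n → replicate n x ++ xs) (+-comm (2 * t) 1)

  -- A segment of 2t tree edges from a leaf back to a leaf climbs exactly t levels and descends t levels.
  balanced : ∀ {u d t depth} → u + d ≡ 2 * t → u ≤ depth → depth ∸ u + d ≡ depth → u ≡ t × d ≡ t
  balanced {u} {d} {t} {depth} u+d≡ u≤depth ends = u≡t , trans d≡u u≡t
    where
    d≡u : d ≡ u
    d≡u = +-cancelˡ-≡ (depth ∸ u) d u (trans ends (sym (m∸n+n≡m u≤depth)))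
    u≡t : u ≡ t
    u≡t = *-cancelˡ-≡ u t 2 (trans (cong (u +_) (trans (+-identityʳ u) (sym d≡u))) u+d≡)

  treeSegment-complete : ∀ t s a M Rs k → length a ≡ h → PathTail (tree s a ∷ M) →
                         map region M ≡ replicate (2 * t) Tr ++ Rs → Accepts k Rs → (tree s a ∷ M) ∈ treeSegments s a t t k
  treeSegment-complete t s a M Rs k leaf tail regs accepts with segment-complete (2 * t) s a M Rs k tail regs accepts
  ... | u , d , u+d≡ , u≤ , ends , M∈ with balanced {u} {d} {t} {h} u+d≡ (subst (u ≤_) leaf u≤) (subst (λ depth → depth ∸ u + d ≡ h) leaf ends)
  ... | refl , refl = M∈

  final-accepts : Accepts (λ _ _ → [ [] ]) []
  final-accepts s a []      (_ , _ , _ , leaf) _ = leaf , here refl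
  final-accepts s a (v ∷ M) _                   ()

  paths-complete : ∀ ts s a M → OddLength ts → length a ≡ h → PathTail (tree s a ∷ M) →
                   map region (tree s a ∷ M) ≡ expected c ts → (tree s a ∷ M) ∈ paths s a ts
  climb-accepts : ∀ e ts → OddLength ts →
                  Accepts (climb e ts) (replicate c₁ Cn ++ replicate (c * e + 1) Ex ++ replicate c₁ Cn ++ expected c ts)
  descend-accepts : ∀ ts → OddLength ts → AcceptsAt (descend ts) (replicate c₁ Cn ++ expected c ts)

  paths-complete (t ∷ []) s a M _ leaf tail regs =
    treeSegment-complete t s a M [] _ leaf tail
      (proj₂ (∷-injective (trans regs (trans (sym (++-identityʳ (replicate (2 * t + 1) Tr))) (replicate-odd t Tr []))))) final-accepts
  paths-complete (t ∷ e ∷ ts) s a M odd leaf tail regs =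
    treeSegment-complete t s a M _ (climb e ts) leaf tail (proj₂ (∷-injective (trans regs (replicate-odd t Tr _)))) (climb-accepts e ts odd)

  climb-accepts e ts odd s a [] _ regs with trans regs (replicate-head c₁ Cn _ 1≤c₁)
  ... | ()
  climb-accepts e ts odd s a (v ∷ ws) tail@((a~v , walk) , (_ ∷ valid ∷ valids) , uniq , _) regs
    with tree-exit a~v (proj₁ (∷-injective (trans regs (replicate-head c₁ Cn _ 1≤c₁))))
  ... | refl with traverse (upPath s a) (upPath-forced s a) (tree s a) (conn s a 1) ws refl
                          (sym (pathVertex-interior (tree s a) (conn s a) (avert (f s a)) 1 (s≤s z≤n) 1≤c₁))
                          (a~v , walk) uniq valids (regions-length-≥ (conn s a 1) ws c₁ Cn _ regs nonempty)
    where nonempty : 1 ≤ length (replicate (c * e + 1) Ex ++ replicate c₁ Cn ++ expected c ts)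
          nonempty = subst (λ n → 1 ≤ length (replicate n Ex ++ replicate c₁ Cn ++ expected c ts)) (+-comm 1 (c * e)) (s≤s z≤n)
  ... | rest , ws≡ = proj₁ (proj₁ valid) , subst (_∈ climb e ts s a) (sym M≡) (∈-map⁺ (interior (upPath s a) ++_) rest∈)
    where
    M≡ : conn s a 1 ∷ ws ≡ interior (upPath s a) ++ avert (f s a) ∷ rest
    M≡ = trans ws≡ (cong (λ z → interior (upPath s a) ++ z ∷ rest) (pathVertex-end (tree s a) (conn s a) (avert (f s a))))
    regs′ : map region (avert (f s a) ∷ rest) ≡ Ex ∷ replicate (c * e) Ex ++ replicate c₁ Cn ++ expected c ts
    regs′ = trans (regions-drop (interior (upPath s a)) (avert (f s a) ∷ rest) c₁ Cn _ (trans (cong (map region) (sym M≡)) regs)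
                                (length-interior (upPath s a)))
                  (cong (λ n → replicate n Ex ++ replicate c₁ Cn ++ expected c ts) (+-comm (c * e) 1))
    tail′ : PathTail (avert (f s a) ∷ rest)
    tail′ = PathTail-suffix (tree s a ∷ interior (upPath s a)) (avert (f s a)) rest (subst (λ W → PathTail (tree s a ∷ W)) M≡ tail)
    rest∈ : (avert (f s a) ∷ rest) ∈ expanderWalks nothing (f s a) e (descend ts)
    rest∈ = expanderWalks-complete e nothing (f s a) rest _ (descend ts) tail′ (proj₂ (∷-injective regs′)) tt (descend-accepts ts odd)

  descend-accepts ts odd z [] _ regs with trans regs (replicate-head c₁ Cn (expected c ts) 1≤c₁)
  ... | ()
  descend-accepts ts odd z (v ∷ ws) tail@((z~v , walk) , (_ ∷ valid ∷ valids) , uniq , _) regs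
    with traverse (downPath z) (downPath-forced z) (avert z) v ws (cong avert (sym (f-leafOf z)))
                  (avert-exit-down z~v valid (proj₁ (∷-injective (trans regs (replicate-head c₁ Cn (expected c ts) 1≤c₁)))))
                  (z~v , walk) uniq valids (regions-length-≥ v ws c₁ Cn (expected c ts) regs (expected-nonempty ts odd))
  ... | rest , ws≡ = subst (_∈ descend ts z) (sym M≡) (∈-map⁺ (interior (downPath z) ++_) rest∈)
    where
    s′ : Side
    s′ = sideOf z
    a′ : List ℕ
    a′ = leafOf z
    M≡ : v ∷ ws ≡ interior (downPath z) ++ tree s′ a′ ∷ rest
    M≡ = trans ws≡ (cong (λ w → interior (downPath z) ++ w ∷ rest) (pathVertex-end (avert (f s′ a′)) (reversed (conn s′ a′)) (tree s′ a′)))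
    regs′ : map region (tree s′ a′ ∷ rest) ≡ expected c ts
    regs′ = regions-drop (interior (downPath z)) (tree s′ a′ ∷ rest) c₁ Cn (expected c ts)
                         (trans (cong (map region) (sym M≡)) regs) (length-interior (downPath z))
    tail′ : PathTail (tree s′ a′ ∷ rest)
    tail′ = PathTail-suffix (avert z ∷ interior (downPath z)) (tree s′ a′) rest (subst (λ W → PathTail (avert z ∷ W)) M≡ tail)
    rest∈ : (tree s′ a′ ∷ rest) ∈ paths s′ a′ ts
    rest∈ = paths-complete ts s′ a′ rest odd (proj₁ (leafOf-leaf z)) tail′ regs′

  descents : ℕ → ℕ → ℕ
  descents depth zero    = 1
  descents depth (suc n) = branching h depth * descents (suc depth) n

  treeSegments-length : ∀ s a u d k M → (∀ s′ a′ → length (k s′ a′) ≤ M) →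
                        length (treeSegments s a u d k) ≤ descents (length a ∸ u) d * M
  treeSegments-length s a zero zero k M bound =
    ≤-trans (≤-reflexive (length-map (tree s a ∷_) (k s a))) (≤-trans (bound s a) (≤-reflexive (sym (+-identityʳ M))))
  treeSegments-length s a zero (suc d) k M bound = begin
    length (concatMap (λ i → map (tree s a ∷_) (treeSegments s (a ++ [ i ]) zero d k)) (downFrom (branching h (length a))))
      ≤⟨ length-concatMap-≤ (downFrom (branching h (length a))) _ (descents (suc (length a)) d * M) perChild ⟩
    length (downFrom (branching h (length a))) * (descents (suc (length a)) d * M)
      ≡⟨ cong (_* (descents (suc (length a)) d * M)) (length-downFrom (branching h (length a))) ⟩
    branching h (length a) * (descents (suc (length a)) d * M)
      ≡⟨ *-assoc (branching h (length a)) (descents (suc (length a)) d) M ⟨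
    descents (length a) (suc d) * M ∎
    where
    open ≤-Reasoning
    perChild : ∀ i → i ∈ downFrom (branching h (length a)) →
            length (map (tree s a ∷_) (treeSegments s (a ++ [ i ]) zero d k)) ≤ descents (suc (length a)) d * M
    perChild i _ = ≤-trans (≤-reflexive (length-map (tree s a ∷_) (treeSegments s (a ++ [ i ]) zero d k)))
                        (≤-trans (treeSegments-length s (a ++ [ i ]) zero d k M bound)
                                 (≤-reflexive (cong (λ depth → descents depth d * M) (length-snoc a i))))
  treeSegments-length s []      (suc u) d k M bound = z≤n
  treeSegments-length s (x ∷ a) (suc u) d k M bound =
    ≤-trans (≤-reflexive (length-map (tree s (x ∷ a) ∷_) (treeSegments s (parent (x ∷ a)) u d k)))
            (≤-trans (treeSegments-length s (parent (x ∷ a)) u d k M bound)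
                     (≤-reflexive (cong (λ depth → descents (depth ∸ u) d * M) (length-parent x a))))

  treeSegments-too-high : ∀ s a u d k → length a < u → treeSegments s a u d k ≡ []
  treeSegments-too-high s []      (suc u) d k _ = refl
  treeSegments-too-high s (x ∷ a) (suc u) d k (s≤s a<u)
    rewrite treeSegments-too-high s (parent (x ∷ a)) u d k (subst (_< u) (sym (length-parent x a)) a<u) = refl

  choices-length : ∀ q x → q ∈ nbrs x → length (choices (just q) x) ≤ 2
  choices-length q x q∈ = ≤-pred (≤-trans (filter-notAll (λ y → ¬? (y ≟ᶠ q)) (nbrs x) (Any.map (λ q≡ y≢q → y≢q (sym q≡)) q∈))
                                          (≤-reflexive (length-nbrs x)))

  expanderWalks-length : ∀ q x e K M → q ∈ nbrs x → (∀ z → length (K z) ≤ M) → length (expanderWalks (just q) x e K) ≤ 2 ^ e * M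
  expanderWalks-length q x zero K M _ bound =
    ≤-trans (≤-reflexive (length-map (avert x ∷_) (K x))) (≤-trans (bound x) (≤-reflexive (sym (+-identityʳ M))))
  expanderWalks-length q x (suc e) K M q∈ bound =
    ≤-trans (length-concatMap-≤ (choices (just q) x) _ (2 ^ e * M) step)
            (≤-trans (*-monoˡ-≤ (2 ^ e * M) (choices-length q x q∈)) (≤-reflexive (sym (*-assoc 2 (2 ^ e) M))))
    where
    step : ∀ y → y ∈ choices (just q) x → length (map (λ w → avert x ∷ (interior (edgePath x y) ++ w)) (expanderWalks (just x) y e K)) ≤ 2 ^ e * M
    step y y∈ = ≤-trans (≤-reflexive (length-map _ (expanderWalks (just x) y e K)))
                        (expanderWalks-length x y e K M (adj⇒∈nbrs (adj-sym (∈nbrs⇒adj (proj₁ (∈-filter⁻ (λ y → ¬? (y ≟ᶠ q)) {xs = nbrs x} y∈))))) bound)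

  expanderWalks-length-start : ∀ x e K M → (∀ z → length (K z) ≤ M) → length (expanderWalks nothing x e K) ≤ ce e * M
  expanderWalks-length-start x zero K M bound =
    ≤-trans (≤-reflexive (length-map (avert x ∷_) (K x))) (≤-trans (bound x) (≤-reflexive (sym (+-identityʳ M))))
  expanderWalks-length-start x (suc e) K M bound =
    ≤-trans (length-concatMap-≤ (nbrs x) _ (2 ^ e * M) step)
            (≤-reflexive (trans (cong (_* (2 ^ e * M)) (length-nbrs x)) (sym (*-assoc 3 (2 ^ e) M))))
    where
    step : ∀ y → y ∈ nbrs x → length (map (λ w → avert x ∷ (interior (edgePath x y) ++ w)) (expanderWalks (just x) y e K)) ≤ 2 ^ e * M
    step y y∈ = ≤-trans (≤-reflexive (length-map _ (expanderWalks (just x) y e K)))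
                        (expanderWalks-length x y e K M (adj⇒∈nbrs (adj-sym (∈nbrs⇒adj y∈))) bound)

  module Counting (a : ℕ) (h≡ : h ≡ a + a) (h/2≡ : h / 2 ≡ a) where
    open TreeWeight a

    branching-top : ∀ {depth} → depth < a → branching h depth ≡ 3
    branching-top {depth} d<a rewrite h/2≡ = if-true (depth <ᵇ a) (<⇒<ᵇ d<a)

    branching-bottom : ∀ {depth} → a ≤ depth → branching h depth ≡ 2
    branching-bottom {depth} a≤d rewrite h/2≡ = if-false (depth <ᵇ a) (λ lt → <⇒≱ (<ᵇ⇒< depth a lt) a≤d)

    μ-step : ∀ t → suc t ≤ h → μ (suc t) ≡ branching h (h ∸ suc t) * μ t
    μ-step t st≤h = bySide (suc t ≤? a)
      where
      open ≡-Reasoning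
      st≤ : suc t ≤ a + a
      st≤ = subst (suc t ≤_) h≡ st≤h
      μ≡lam : μ t ≡ lamA t
      μ≡lam = μ-in (<⇒≤ st≤)
      bySide : Dec (suc t ≤ a) → μ (suc t) ≡ branching h (h ∸ suc t) * μ t
      bySide (yes st≤a) = begin
        μ (suc t)                      ≡⟨ μ-in st≤ ⟩
        lamA (suc t)                   ≡⟨ lam-step-low st≤a ⟩
        2 * lamA t                     ≡⟨ cong₂ _*_ (sym (branching-bottom deep)) (sym μ≡lam) ⟩
        branching h (h ∸ suc t) * μ t  ∎
        where
        deep : a ≤ h ∸ suc t
        deep = subst (a ≤_) (sym (trans (cong (_∸ suc t) h≡) (+-∸-assoc a st≤a))) (m≤m+n a (a ∸ suc t))
      bySide (no st≰a) = begin
        μ (suc t)                      ≡⟨ μ-in st≤ ⟩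
        lamA (suc t)                   ≡⟨ lam-step-high a≤t ⟩
        3 * lamA t                     ≡⟨ cong₂ _*_ (sym (branching-top shallow)) (sym μ≡lam) ⟩
        branching h (h ∸ suc t) * μ t  ∎
        where
        a≤t : a ≤ t
        a≤t = ≤-pred (≰⇒> st≰a)
        positive : ∀ a → a ≤ t → suc t ≤ a + a → 0 < a
        positive (suc _) _ _ = s≤s z≤n
        shallow : h ∸ suc t < a
        shallow = subst (_< a) (sym (cong (_∸ suc t) h≡))
                        (m<n+o⇒m∸n<o (a + a) (suc t) {{>-nonZero (positive a a≤t st≤)}} (+-monoˡ-< a (s≤s a≤t)))

    descents-to-leaf : ∀ t → t ≤ h → descents (h ∸ t) t ≡ μ t
    descents-to-leaf zero    _     = sym μ-zero
    descents-to-leaf (suc t) st≤h = begin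
      branching h (h ∸ suc t) * descents (suc (h ∸ suc t)) t ≡⟨ cong (λ d → branching h (h ∸ suc t) * descents d t) (+-∸-assoc 1 st≤h) ⟨
      branching h (h ∸ suc t) * descents (h ∸ t) t           ≡⟨ cong (branching h (h ∸ suc t) *_) (descents-to-leaf t (<⇒≤ st≤h)) ⟩
      branching h (h ∸ suc t) * μ t                          ≡⟨ μ-step t st≤h ⟨
      μ (suc t)                                              ∎
      where open ≡-Reasoning

    treeSegments-length-leaf : ∀ s b t k M → length b ≡ h → (∀ s′ b′ → length (k s′ b′) ≤ M) →
                               length (treeSegments s b t t k) ≤ μ t * M
    treeSegments-length-leaf s b t k M leaf bound with t ≤? h
    ... | yes t≤h = ≤-trans (treeSegments-length s b t t k M bound)
                            (≤-reflexive (cong (_* M) (trans (cong (λ depth → descents (depth ∸ t) t) leaf) (descents-to-leaf t t≤h))))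
    ... | no  t≰h rewrite treeSegments-too-high s b t t k (subst (_< t) (sym leaf) (≰⇒> t≰h)) = z≤n

    paths-length : ∀ ts s b → length b ≡ h → length (paths s b ts) ≤ wt ts
    paths-length []           s b leaf = z≤n
    paths-length (t ∷ [])     s b leaf =
      ≤-trans (treeSegments-length-leaf s b t (λ _ _ → [ [] ]) 1 leaf (λ _ _ → ≤-refl)) (≤-reflexive (*-identityʳ (μ t)))
    paths-length (t ∷ e ∷ ts) s b leaf = treeSegments-length-leaf s b t (climb e ts) (ce e * wt ts) leaf climb-length
      where
      descend-length : ∀ z → length (descend ts z) ≤ wt ts
      descend-length z = ≤-trans (≤-reflexive (length-map (interior (downPath z) ++_) (paths (sideOf z) (leafOf z) ts)))
                                 (paths-length ts (sideOf z) (leafOf z) (proj₁ (leafOf-leaf z)))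
      climb-length : ∀ s′ b′ → length (climb e ts s′ b′) ≤ ce e * wt ts
      climb-length s′ b′ = ≤-trans (≤-reflexive (length-map (interior (upPath s′ b′) ++_) (expanderWalks nothing (f s′ b′) e (descend ts))))
                                   (expanderWalks-length-start (f s′ b′) e (descend ts) (wt ts) descend-length)

combine-squares : ∀ P w S p G f₄ f₉ K → P ≤ w * S → w * w * f₄ ≤ f₉ * (p * p) → S * S ≤ 4 * (K * K) * G →
                  P ^ 2 * f₄ ≤ 4 * K ^ 2 * f₉ * p ^ 2 * G
combine-squares P w S p G f₄ f₉ K P≤ w-sq S-sq = begin
  P ^ 2 * f₄                          ≡⟨ cong (_* f₄) (square P) ⟩
  P * P * f₄                          ≤⟨ *-monoˡ-≤ f₄ (*-mono-≤ P≤ P≤) ⟩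
  w * S * (w * S) * f₄                ≡⟨ regroup₁ w S f₄ ⟩
  w * w * f₄ * (S * S)                ≤⟨ *-mono-≤ w-sq S-sq ⟩
  f₉ * (p * p) * (4 * (K * K) * G)    ≡⟨ regroup₂ f₉ p K G ⟩
  4 * (K * K) * f₉ * (p * p) * G      ≡⟨ cong₂ (λ u v → 4 * u * f₉ * v * G) (square K) (square p) ⟨
  4 * K ^ 2 * f₉ * p ^ 2 * G          ∎
  where
  open ≤-Reasoning
  square : ∀ x → x ^ 2 ≡ x * x
  square x = cong (x *_) (*-identityʳ x)
  regroup₁ : ∀ a b c → a * b * (a * b) * c ≡ a * a * c * (b * b)
  regroup₁ = solve-∀
  regroup₂ : ∀ a b c d → a * (b * b) * (4 * (c * c) * d) ≡ 4 * (c * c) * a * (b * b) * d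
  regroup₂ = solve-∀

module Estimate (c₁ half : ℕ) (1≤c₁ : 1 ≤ c₁) (1≤half : 1 ≤ half) (c≡ : suc c₁ ≡ half * 2)
                (h a : ℕ) (h≡ : h ≡ a + a) (h/2≡ : h / 2 ≡ a)
                {N : ℕ} (adjA : Fin N → Fin N → Set) (f : Side → List ℕ → Fin N)
                (cubic : IsCubic adjA) (bij : IsLeafBijection h f) where
  open PathEnumeration c₁ h adjA f cubic bij 1≤c₁
  open Counting a h≡ h/2≡
  open TreeWeight a using (wt; prefixWt; wt-++; prefixWt-sq)
  open PatternSum a half 1≤half

  budget : List ℕ → ℕ
  budget s = (h + 1) ∸ halfLen s

  module _ (ℓ r : ℕ) (ℓ≤r : ℓ ≤ r) (s : List ℕ) (length-s : length s ≡ 2 * ℓ) where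

    suffix-length : ∀ rest → length (s ++ rest) ≡ 2 * r + 1 → length rest ≡ 2 * (r ∸ ℓ) + 1
    suffix-length rest len = +-cancelˡ-≡ (2 * ℓ) (length rest) (2 * (r ∸ ℓ) + 1) (begin
      2 * ℓ + length rest          ≡⟨ cong (_+ length rest) length-s ⟨
      length s + length rest       ≡⟨ length-++ s ⟨
      length (s ++ rest)           ≡⟨ len ⟩
      2 * r + 1                    ≡⟨ cong (λ z → 2 * z + 1) (m+[n∸m]≡n ℓ≤r) ⟨
      2 * (ℓ + (r ∸ ℓ)) + 1        ≡⟨ regroup ℓ (r ∸ ℓ) ⟩
      2 * ℓ + (2 * (r ∸ ℓ) + 1)    ∎)
      where open ≡-Reasoning
            regroup : ∀ ℓ m → 2 * (ℓ + m) + 1 ≡ 2 * ℓ + (2 * m + 1)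
            regroup = solve-∀

    suffix-fits : ∀ rest → patLen c (s ++ rest) ≤ 2 * h + 2 → halfLen rest ≤ budget s
    suffix-fits rest fits = m+n≤o⇒m≤o∸n (halfLen rest) (≤-trans (≤-reflexive (+-comm (halfLen rest) (halfLen s))) (*-cancelˡ-≤ 2 doubled))
      where
      patLen≡ : patLen c (s ++ rest) ≡ 2 * (halfLen s + halfLen rest)
      patLen≡ = begin
        2 * sumOdd (s ++ rest) + suc c₁ * sumEven2 (s ++ rest)
          ≡⟨ cong₂ (λ p q → 2 * p + suc c₁ * q) (sumOdd-++ ℓ s rest length-s) (sumEven2-++ ℓ s rest length-s) ⟩
        2 * (sumOdd s + sumOdd rest) + suc c₁ * (sumEven2 s + sumEven2 rest)
          ≡⟨ cong (λ z → 2 * (sumOdd s + sumOdd rest) + z * (sumEven2 s + sumEven2 rest)) c≡ ⟩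
        2 * (sumOdd s + sumOdd rest) + half * 2 * (sumEven2 s + sumEven2 rest)
          ≡⟨ regroup (sumOdd s) (sumOdd rest) (sumEven2 s) (sumEven2 rest) half ⟩
        2 * (halfLen s + halfLen rest) ∎
        where open ≡-Reasoning
              regroup : ∀ a b x y half → 2 * (a + b) + half * 2 * (x + y) ≡ 2 * (a + half * x + (b + half * y))
              regroup = solve-∀
      doubled : 2 * (halfLen s + halfLen rest) ≤ 2 * (h + 1)
      doubled = ≤-trans (≤-reflexive (sym patLen≡)) (≤-trans fits (≤-reflexive (sym (*-distribˡ-+ 2 h 1))))

    Ps-listed : ∀ u → IsLeaf h u → ∀ P → InPs h c adjA f u r s P →
                P ∈ concatMap (λ rest → paths L u (s ++ rest)) (patterns (r ∸ ℓ) (budget s))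
    Ps-listed u leaf-u P ((walk , valid , uniq , _ , (ys , refl) , (xs , b , leaf-b , P≡)) , t , (length-t , fits) , (rest , refl) , regs) =
      ∈-concatMap {g = λ rest → paths L u (s ++ rest)}
        (paths-complete (s ++ rest) L u ys (odd-length (s ++ rest) r length-t) (proj₁ leaf-u)
                        (walk , valid , uniq , subst EndsAtLeaf (sym P≡) (EndsAtLeaf-snoc xs R b (proj₁ leaf-b))) regs)
        (patterns-complete (r ∸ ℓ) (budget s) rest (suffix-length rest length-t) (suffix-fits rest fits))

    Ps-count : ∀ u → IsLeaf h u → ∀ Ps → Unique Ps → All (InPs h c adjA f u r s) Ps →
               length Ps ≤ prefixWt s * totalWt (patterns (r ∸ ℓ) (budget s))
    Ps-count u leaf-u Ps uniq inPs = begin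
      length Ps
        ≤⟨ unique-length-≤ Ps _ uniq (λ P P∈ → Ps-listed u leaf-u P (All.lookup inPs P∈)) ⟩
      length (concatMap (λ rest → paths L u (s ++ rest)) (patterns (r ∸ ℓ) (budget s)))
        ≤⟨ length-concatMap-sum (patterns (r ∸ ℓ) (budget s)) (λ rest → paths L u (s ++ rest)) (λ rest → prefixWt s * wt rest)
             (λ rest → ≤-trans (paths-length (s ++ rest) L u (proj₁ leaf-u)) (≤-reflexive (wt-++ ℓ s rest length-s))) ⟩
      sum (map (λ rest → prefixWt s * wt rest) (patterns (r ∸ ℓ) (budget s)))
        ≡⟨ sum-map-scale (patterns (r ∸ ℓ) (budget s)) wt (prefixWt s) ⟩
      prefixWt s * totalWt (patterns (r ∸ ℓ) (budget s)) ∎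
      where open ≤-Reasoning

    -- W(t_[2ℓ]) is the budget left once the  r - ℓ  remaining blocks have paid for their connections.
    W≡ : W h c r ℓ s ≡ budget s ∸ 2 * half * (r ∸ ℓ)
    W≡ = trans (cong (_/ 2) doubled) (trans (cong (_/ 2) (*-comm 2 Y)) (m*n/n≡m Y 2))
      where
      open ≡-Reasoning
      m So Se Y : ℕ
      m = r ∸ ℓ
      So = sumOdd s
      Se = sumEven2 s
      Y = budget s ∸ 2 * half * m
      doubled : (2 * h + 2) ∸ 2 * So ∸ suc c₁ * Se ∸ 2 * suc c₁ * m ≡ 2 * Y
      doubled = begin
        (2 * h + 2) ∸ 2 * So ∸ suc c₁ * Se ∸ 2 * suc c₁ * m
          ≡⟨ cong₂ (λ p q → (2 * h + 2) ∸ 2 * So ∸ p ∸ q) (trans (cong (_* Se) c≡) (regroup₁ half Se)) (trans (cong (λ z → 2 * z * m) c≡) (regroup₂ half m)) ⟩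
        (2 * h + 2) ∸ 2 * So ∸ 2 * (half * Se) ∸ 2 * (2 * half * m)
          ≡⟨ cong (λ z → z ∸ 2 * So ∸ 2 * (half * Se) ∸ 2 * (2 * half * m)) (*-distribˡ-+ 2 h 1) ⟨
        2 * (h + 1) ∸ 2 * So ∸ 2 * (half * Se) ∸ 2 * (2 * half * m)
          ≡⟨ cong (λ z → z ∸ 2 * (half * Se) ∸ 2 * (2 * half * m)) (*-distribˡ-∸ 2 (h + 1) So) ⟨
        2 * (h + 1 ∸ So) ∸ 2 * (half * Se) ∸ 2 * (2 * half * m)
          ≡⟨ cong (_∸ 2 * (2 * half * m)) (*-distribˡ-∸ 2 (h + 1 ∸ So) (half * Se)) ⟨
        2 * (h + 1 ∸ So ∸ half * Se) ∸ 2 * (2 * half * m)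
          ≡⟨ *-distribˡ-∸ 2 (h + 1 ∸ So ∸ half * Se) (2 * half * m) ⟨
        2 * (h + 1 ∸ So ∸ half * Se ∸ 2 * half * m)
          ≡⟨ cong (λ z → 2 * (z ∸ 2 * half * m)) (∸-+-assoc (h + 1) So (half * Se)) ⟩
        2 * Y ∎
        where
        regroup₁ : ∀ half s → half * 2 * s ≡ 2 * (half * s)
        regroup₁ = solve-∀
        regroup₂ : ∀ half m → 2 * (half * 2) * m ≡ 2 * (2 * half * m)
        regroup₂ = solve-∀

    Ps-bound : ∀ u → IsLeaf h u → ∀ Ps → Unique Ps → All (InPs h c adjA f u r s) Ps →
               length Ps ^ 2 * 4 ^ ℓ ≤ 4 * (9747 ^ (r ∸ ℓ)) ^ 2 * 9 ^ ℓ * prodTerm h s ^ 2 * 6 ^ W h c r ℓ s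
    Ps-bound u leaf-u Ps uniq inPs =
      combine-squares (length Ps) (prefixWt s) (totalWt (patterns (r ∸ ℓ) (budget s))) (prodTerm h s) (6 ^ W h c r ℓ s) (4 ^ ℓ) (9 ^ ℓ) (9747 ^ (r ∸ ℓ))
        (Ps-count u leaf-u Ps uniq inPs)
        (prefixWt-sq h h/2≡ ℓ s length-s)
        (subst (λ w → S * S ≤ 4 * (9747 ^ (r ∸ ℓ) * 9747 ^ (r ∸ ℓ)) * 6 ^ w) (sym W≡) (patterns-bound-sq (r ∸ ℓ) (budget s)))
      where S : ℕ
            S = totalWt (patterns (r ∸ ℓ) (budget s))

even-half : ∀ h a → h ≡ a * 2 → h ≡ a + a × h / 2 ≡ a
even-half h a h≡ = trans h≡ (trans (*-comm a 2) (cong (a +_) (+-identityʳ a))) , trans (cong (_/ 2) h≡) (m*n/n≡m a 2)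

even-positive : ∀ c₁ half → suc c₁ ≡ half * 2 → 1 ≤ c₁ × 1 ≤ half
even-positive zero       (suc half) eq with suc-injective eq
... | ()
even-positive (suc c₁)   (suc half) _  = s≤s z≤n , s≤s z≤n

mainTheorem7 : (c : ℕ) → 2 ∣ c → 0 < c →
    ∃[ C ] ((h : ℕ) → 2 ∣ h → 0 < h →
      (adjA : Fin (2 * 6 ^ (h / 2)) → Fin (2 * 6 ^ (h / 2)) → Set) → IsCubic adjA →
      (f : Side → List ℕ → Fin (2 * 6 ^ (h / 2))) → IsLeafBijection h f →
      (u : List ℕ) → IsLeaf h u →
      (r : ℕ) → 1 ≤ r → (ℓ : ℕ) → ℓ ≤ r →
      (s : List ℕ) → length s ≡ 2 * ℓ → IsPrefixOfValid h c r s →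
      (Ps : List (List (V (2 * 6 ^ (h / 2))))) → Unique Ps → All (InPs h c adjA f u r s) Ps →
      length Ps ^ 2 * 4 ^ ℓ
        ≤ 4 * (C ^ (r ∸ ℓ)) ^ 2 * 9 ^ ℓ * prodTerm h s ^ 2 * 6 ^ W h c r ℓ s)
mainTheorem7 zero     _                 ()
mainTheorem7 (suc c₁) (divides half c≡) _ =
  9747 , λ { h (divides a h≡) _ adjA cubic f bij u leaf-u r _ ℓ ℓ≤r s length-s _ Ps uniq inPs →
    Estimate.Ps-bound c₁ half (proj₁ c-positive) (proj₂ c-positive) c≡ h a (proj₁ (even-half h a h≡)) (proj₂ (even-half h a h≡))
                      adjA f cubic bij ℓ r ℓ≤r s length-s u leaf-u Ps uniq inPs }
  where c-positive : 1 ≤ c₁ × 1 ≤ half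
        c-positive = even-positive c₁ half c≡
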